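{- There exists an absolute constant $C>0$ such that for every odd prime $p$, $$\kappa_p \le C\sqrt{\eta_{0,p}},$$ i.e. $\kappa_p\in O(\sqrt{\eta_{0,p}})$ as $p$ ranges over the odd primes.
   Context: Let $p$ be an odd prime. For an integer $k$ with $k\not\equiv 0 \pmod p$, the Fermat quotient $q_p(k)$ is the unique integer in $\{0,1,\dots,p-1\}$ such that $k^{p-1}\equiv 1+q_p(k)\,p \pmod{p^2}$. Define $\kappa_p:=\min\{n>0 \mid q_p(n)\neq 0\}$. The Mirimanoff polynomial is $\gamma_p(t):=\sum_{j=1}^{p-1} \frac{t^j}{j}$, regarded as a polynomial with coefficients in $\mathbb{F}_p$ (so $1/j$ is the inverse of $j$ modulo $p$). Define $\eta_{0,p}:=|\{c \mid 0\le c<p,\ \gamma_p(c)\equiv 0 \pmod p\}|$. -}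

module Defs where

open import Data.Nat using (ℕ; zero; suc; _+_; _*_; _∸_; _^_; _/_; _%_; _≟_)
open import Data.Nat.Divisibility using (_∣?_)
open import Data.Bool using (Bool; true; false; not; _∧_)
open import Data.List using (List; upTo; filter; length; map; drop)
open import Data.Nat.ListAction using (sum)
open import Relation.Nullary.Decidable using (does; ⌊_⌋)

-- First n in [start, start + fuel) with P n = true; returns start + fuel if none.
firstFrom : (ℕ → Bool) → ℕ → ℕ → ℕ
firstFrom P start zero = start
firstFrom P start (suc fuel) with P start
... | true  = start
... | false = firstFrom P (suc start) fuel

-- Fermat quotient q_p(k) ∈ {0,…,p-1}:  k^(p-1) = 1 + q_p(k) p  (mod p²),
-- computed as ((k^(p-1) - 1) / p) mod p  (meaningful for p prime, p ∤ k).
-- (p = 0 is a junk case; the statement only uses primes p.)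
fermatQuotient : ℕ → ℕ → ℕ
fermatQuotient zero    k = 0
fermatQuotient (suc m) k = ((k ^ m ∸ 1) / suc m) % suc m

-- "q_p(n) ≠ 0" (only meaningful, hence only considered, for p ∤ n)
qNonzero : ℕ → ℕ → Bool
qNonzero p n = not ⌊ p ∣? n ⌋ ∧ not ⌊ fermatQuotient p n ≟ 0 ⌋

-- κ_p = min { n > 0 | q_p(n) ≠ 0 }.
-- The search runs over n = 1 … p+1; this is exact because q_p(p+1) = p-1 ≠ 0
-- for every odd prime p, so the minimum always lies in that range.
kappa : ℕ → ℕ
kappa p = firstFrom (qNonzero p) 1 (suc p)

invMod : ℕ → ℕ → ℕ
invMod zero    j = 0
invMod (suc m) j = firstFrom (λ i → ⌊ (i * j) % suc m ≟ 1 ⌋) 0 (suc m)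

-- Mirimanoff polynomial γ_p(t) = Σ_{j=1}^{p-1} t^j / j, evaluated at c, reduced mod p
mirimanoff : ℕ → ℕ → ℕ
mirimanoff zero    c = 0
mirimanoff (suc m) c =
  sum (map (λ j → c ^ j * invMod (suc m) j) (drop 1 (upTo (suc m)))) % suc m

eta0 : ℕ → ℕ
eta0 p = length (filter (λ c → mirimanoff p c ≟ 0) (upTo p))

-- Let m = min(κ_p − 1, p − 1). Every 1 ≤ j ≤ m has q_p(j) = 0, i.e. j^p ≡ j (mod p²), and this
-- property is closed under products and negation. For 1 ≤ a, b ≤ m let c ≡ a/b (mod p). From
-- b − cb ≡ b − a and cb ≡ a (mod p) we get b^p ((1 − c)^p + c^p) ≡ (b − a)^p + a^p ≡ b (mod p²),
-- so (1 − c)^p + c^p ≡ 1 (mod p²). Expanding binomially with C(p, j) ≡ (−1)^(j−1) p / j (mod p²)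
-- turns this into γ_p(c) ≡ 0 (mod p). The same p-th power argument shows that a/b ≡ a′/b′ (mod p)
-- forces ab′ ≡ a′b (mod p²), hence ab′ = a′b; so distinct coprime pairs (a, b) give distinct roots
-- c, and η_{0,p} is at least the number of coprime pairs in [1, m]², which is ≥ m²/3 by the sieve
-- Σ_{d ≥ 2} ⌊m/d⌋² ≤ (2/3) m². Finally κ_p ≤ m + 3 ≤ 4m, so κ_p² ≤ 48 η_{0,p}.
module Submission where

open import Defs

module Congruences where

  open import Data.Fin using (Fin; toℕ; zero; suc; inject₁; fromℕ)
  open import Data.Vec.Functional using (init; last; tail)
  open import Data.Fin.Properties using (toℕ-inject₁; toℕ-fromℕ)
  open import Data.Nat as ℕ using (zero; suc)
  open import Data.Nat.Combinatorics using (_C_; nCn≡1)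
  open import Data.Integer using (ℤ; +_; -_; _+_; _-_; _*_; _^_; 0ℤ; 1ℤ; -1ℤ; NonZero)
  open import Data.Integer.Properties
  open import Data.Integer.Divisibility.Signed
  open import Data.Integer.Coprimality using (Coprime; coprime-divisor)
  open import Data.Integer.Tactic.RingSolver using (solve-∀)
  open import Data.Product using (∃; _,_)
  open import Level using (0ℓ)
  open import Relation.Binary.Bundles using (Setoid)
  open import Relation.Binary.Structures using (IsEquivalence)
  open import Relation.Binary.PropositionalEquality
  import Relation.Binary.Reasoning.Setoid as SetoidReasoning
  open import Algebra.Properties.Semiring.Sum +-*-semiring using (sum; sum-syntax; sum-init-last; sum-cong-≗)
  import Algebra.Properties.CommutativeSemiring.Binomial +-*-commutativeSemiring as Binomial
  import Algebra.Properties.Semiring.Exp +-*-semiring as Exp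
  import Algebra.Properties.CommutativeSemiring.Exp +-*-commutativeSemiring as ExpC
  open import Algebra.Properties.Monoid.Mult +-0-monoid using (_×_)

  infix 4 _≡_mod_
  record _≡_mod_ (a b n : ℤ) : Set where
    constructor congruent
    field
      n∣a-b : n ∣ a - b

  module _ {n : ℤ} where

    ≡⇒≡-mod : ∀ {a b} → a ≡ b → a ≡ b mod n
    ≡⇒≡-mod {a} refl = congruent (divides 0ℤ (trans (+-inverseʳ a) (sym (*-zeroˡ n))))

    ≡-mod-sym : ∀ {a b} → a ≡ b mod n → b ≡ a mod n
    ≡-mod-sym {a} {b} (congruent n∣a-b) = congruent (subst (n ∣_) (lemma a b) (∣m⇒∣-m n∣a-b))
      where
      lemma : ∀ a b → - (a - b) ≡ b - a
      lemma = solve-∀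

    ≡-mod-trans : ∀ {a b c} → a ≡ b mod n → b ≡ c mod n → a ≡ c mod n
    ≡-mod-trans {a} {b} {c} (congruent n∣a-b) (congruent n∣b-c) =
      congruent (subst (n ∣_) (+-minus-telescope a b c) (∣m∣n⇒∣m+n n∣a-b n∣b-c))

    +-cong-mod : ∀ {a b c d} → a ≡ b mod n → c ≡ d mod n → a + c ≡ b + d mod n
    +-cong-mod {a} {b} {c} {d} (congruent n∣a-b) (congruent n∣c-d) =
      congruent (subst (n ∣_) (lemma a b c d) (∣m∣n⇒∣m+n n∣a-b n∣c-d))
      where
      lemma : ∀ a b c d → (a - b) + (c - d) ≡ (a + c) - (b + d)
      lemma = solve-∀

    *-cong-mod : ∀ {a b c d} → a ≡ b mod n → c ≡ d mod n → a * c ≡ b * d mod n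
    *-cong-mod {a} {b} {c} {d} (congruent n∣a-b) (congruent n∣c-d) =
      congruent (subst (n ∣_) (lemma a b c d) (∣m∣n⇒∣m+n (∣n⇒∣m*n a n∣c-d) (∣n⇒∣m*n d n∣a-b)))
      where
      lemma : ∀ a b c d → a * (c - d) + d * (a - b) ≡ a * c - b * d
      lemma = solve-∀

    ≡-mod-isEquivalence : IsEquivalence (λ a b → a ≡ b mod n)
    ≡-mod-isEquivalence = record { refl = ≡⇒≡-mod refl ; sym = ≡-mod-sym ; trans = ≡-mod-trans }

    ≡-mod-setoid : Setoid 0ℓ 0ℓ
    ≡-mod-setoid = record { isEquivalence = ≡-mod-isEquivalence }

  module ≡-mod-Reasoning (n : ℤ) = SetoidReasoning (≡-mod-setoid {n})

  module _ {n : ℤ} where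

    +-congˡ-mod : ∀ a {b c} → b ≡ c mod n → a + b ≡ a + c mod n
    +-congˡ-mod a = +-cong-mod (≡⇒≡-mod {a = a} refl)

    +-congʳ-mod : ∀ a {b c} → b ≡ c mod n → b + a ≡ c + a mod n
    +-congʳ-mod a b≡c = +-cong-mod b≡c (≡⇒≡-mod {a = a} refl)

    *-congˡ-mod : ∀ a {b c} → b ≡ c mod n → a * b ≡ a * c mod n
    *-congˡ-mod a = *-cong-mod (≡⇒≡-mod {a = a} refl)

    *-congʳ-mod : ∀ a {b c} → b ≡ c mod n → b * a ≡ c * a mod n
    *-congʳ-mod a b≡c = *-cong-mod b≡c (≡⇒≡-mod {a = a} refl)

  -‿cong-mod : ∀ {n a b} → a ≡ b mod n → - a ≡ - b mod n
  -‿cong-mod {n} {a} {b} (congruent n∣a-b) = congruent (subst (n ∣_) (lemma a b) (∣m⇒∣-m n∣a-b))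
    where
    lemma : ∀ a b → - (a - b) ≡ - a - - b
    lemma = solve-∀

  ≡-mod-weaken : ∀ {n k a b} → a ≡ b mod n * k → a ≡ b mod n
  ≡-mod-weaken {n} {k} (congruent nk∣a-b) = congruent (∣-trans (divides k (*-comm n k)) nk∣a-b)

  private
    *-distribˡ-minus : ∀ k a b → k * (a - b) ≡ k * a - k * b
    *-distribˡ-minus k a b = trans (*-distribˡ-+ k a (- b)) (cong (λ x → k * a + x) (sym (neg-distribʳ-* k b)))

  ≡-mod-scale : ∀ k {n a b} → a ≡ b mod n → k * a ≡ k * b mod k * n
  ≡-mod-scale k {n} {a} {b} (congruent n∣a-b) = congruent (subst (k * n ∣_) (*-distribˡ-minus k a b) (*-monoʳ-∣ k n∣a-b))

  ≡-mod-unscale : ∀ k {n a b} .{{_ : NonZero k}} → k * a ≡ k * b mod k * n → a ≡ b mod n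
  ≡-mod-unscale k {n} {a} {b} (congruent kn∣ka-kb) = congruent (*-cancelˡ-∣ k (subst (k * n ∣_) (sym (*-distribˡ-minus k a b)) kn∣ka-kb))

  ∣⇒≡0-mod : ∀ {n a} → n ∣ a → a ≡ 0ℤ mod n
  ∣⇒≡0-mod {n} {a} n∣a = congruent (subst (n ∣_) (sym (+-identityʳ a)) n∣a)

  ≡0-mod⇒∣ : ∀ {n a} → a ≡ 0ℤ mod n → n ∣ a
  ≡0-mod⇒∣ {n} {a} (congruent n∣a-0) = subst (n ∣_) (+-identityʳ a) n∣a-0

  *-≡0-mod : ∀ {n a b} → a ≡ 0ℤ mod n → b ≡ 0ℤ mod n → a * b ≡ 0ℤ mod n * n
  *-≡0-mod {n} {a} {b} a≡0 b≡0 = ∣⇒≡0-mod (∣-trans (*-monoʳ-∣ n (≡0-mod⇒∣ b≡0)) (*-monoˡ-∣ b (≡0-mod⇒∣ a≡0)))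

  +-cancelʳ-≡-mod : ∀ {n a b} c → a + c ≡ b + c mod n → a ≡ b mod n
  +-cancelʳ-≡-mod {n} {a} {b} c (congruent n∣a+c-b-c) = congruent (subst (n ∣_) (lemma a b c) n∣a+c-b-c)
    where
    lemma : ∀ a b c → a + c - (b + c) ≡ a - b
    lemma = solve-∀

  *-cancelˡ-≡-mod : ∀ {n x a b} → Coprime n x → x * a ≡ x * b mod n → a ≡ b mod n
  *-cancelˡ-≡-mod {n} {x} {a} {b} n⊥x (congruent n∣xa-xb) =
    congruent (∣ᵤ⇒∣ (coprime-divisor n x (a - b) n⊥x (∣⇒∣ᵤ (subst (n ∣_) (sym (*-distribˡ-minus x a b)) n∣xa-xb))))

  *-cancelˡ-≡-mod-square : ∀ {n x a b} .{{_ : NonZero n}} → Coprime n x →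
                           x * a ≡ x * b mod n * n → a ≡ b mod n * n
  *-cancelˡ-≡-mod-square {n} {x} {a} {b} n⊥x (congruent nn∣xa-xb)
    with congruent (divides q a-b≡qn) ← *-cancelˡ-≡-mod {n} {x} {a} {b} n⊥x (≡-mod-weaken {n} {n} {x * a} {x * b} (congruent nn∣xa-xb)) =
    congruent (subst (n * n ∣_) (sym a-b≡qn) (*-monoˡ-∣ n n∣q))
    where
    nn∣xqn : n * n ∣ x * q * n
    nn∣xqn = subst (n * n ∣_) (trans (sym (*-distribˡ-minus x a b)) (trans (cong (x *_) a-b≡qn) (sym (*-assoc x q n)))) nn∣xa-xb
    n∣q : n ∣ q
    n∣q = ∣ᵤ⇒∣ (coprime-divisor n x q n⊥x (∣⇒∣ᵤ (*-cancelʳ-∣ n {n} {x * q} nn∣xqn)))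

  ∑-cong-mod : ∀ {n m} (f g : Fin m → ℤ) → (∀ i → f i ≡ g i mod n) → ∑[ i < m ] f i ≡ ∑[ i < m ] g i mod n
  ∑-cong-mod {m = zero}  f g f≡g = ≡⇒≡-mod refl
  ∑-cong-mod {m = suc m} f g f≡g = +-cong-mod (f≡g zero) (∑-cong-mod (λ i → f (suc i)) (λ i → g (suc i)) (λ i → f≡g (suc i)))

  ∑-≡0-mod : ∀ {n m} (f : Fin m → ℤ) → (∀ i → f i ≡ 0ℤ mod n) → ∑[ i < m ] f i ≡ 0ℤ mod n
  ∑-≡0-mod {m = zero}  f f≡0 = ≡⇒≡-mod refl
  ∑-≡0-mod {m = suc m} f f≡0 = +-cong-mod (f≡0 zero) (∑-≡0-mod (λ i → f (suc i)) (λ i → f≡0 (suc i)))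

  ^≡^ : ∀ x n → x ^ n ≡ x Exp.^ n
  ^≡^ x zero    = refl
  ^≡^ x (suc n) = cong (x *_) (^≡^ x n)

  ×≡* : ∀ n x → n × x ≡ + n * x
  ×≡* zero    x = sym (*-zeroˡ x)
  ×≡* (suc n) x = trans (cong (λ y → x + y) (×≡* n x)) (sym (suc-* (+ n) x))

  ^-distribʳ-* : ∀ x y n → (x * y) ^ n ≡ x ^ n * y ^ n
  ^-distribʳ-* x y n = trans (^≡^ (x * y) n) (trans (ExpC.^-distrib-* x y n) (sym (cong₂ _*_ (^≡^ x n) (^≡^ y n))))

  pos-^ : ∀ m n → + (m ℕ.^ n) ≡ (+ m) ^ n
  pos-^ m zero    = refl
  pos-^ m (suc n) = trans (pos-* m (m ℕ.^ n)) (cong (λ z → + m * z) (pos-^ m n))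

  neg-^ : ∀ x m → (- x) ^ m ≡ -1ℤ ^ m * x ^ m
  neg-^ x m = trans (cong (_^ m) (sym (-1*i≡-i x))) (^-distribʳ-* -1ℤ x m)

  -1^-square : ∀ n → -1ℤ ^ n * -1ℤ ^ n ≡ 1ℤ
  -1^-square n = trans (sym (^-distribʳ-* -1ℤ -1ℤ n)) (^-zeroˡ n)

  neg-^-odd : ∀ x k → (- x) ^ suc (k ℕ.* 2) ≡ - x ^ suc (k ℕ.* 2)
  neg-^-odd x zero    = lemma x
    where
    lemma : ∀ x → - x * 1ℤ ≡ - (x * 1ℤ)
    lemma = solve-∀
  neg-^-odd x (suc k) = trans (cong (λ z → - x * (- x * z)) (neg-^-odd x k)) (lemma x (x ^ suc (k ℕ.* 2)))
    where
    lemma : ∀ x a → - x * (- x * - a) ≡ - (x * (x * a))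
    lemma = solve-∀

  ^-suc-expansion : ∀ b d n → ∃ λ r → (b + d) ^ suc n ≡ b ^ suc n + + suc n * b ^ n * d + d * d * r
  ^-suc-expansion b d zero = 0ℤ , lemma b d
    where
    lemma : ∀ b d → (b + d) * 1ℤ ≡ b * 1ℤ + 1ℤ * 1ℤ * d + d * d * 0ℤ
    lemma = solve-∀
  ^-suc-expansion b d (suc n) with ^-suc-expansion b d n
  ... | r , expansion = b * r + + suc n * b ^ n + d * r , trans (cong ((b + d) *_) expansion) (lemma b d r (b ^ n) (+ suc n))
    where
    lemma : ∀ b d r B k → (b + d) * (b * B + k * B * d + d * d * r)
                           ≡ b * (b * B) + (1ℤ + k) * (b * B) * d + d * d * (b * r + k * B + d * r)
    lemma = solve-∀

  ^-cong-mod-square : ∀ n {a b} → a ≡ b mod + n → a ^ n ≡ b ^ n mod + n * + n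
  ^-cong-mod-square zero    _ = ≡⇒≡-mod refl
  ^-cong-mod-square (suc n) {a} {b} (congruent (divides k a-b≡kN)) with ^-suc-expansion b (k * + suc n) n
  ... | r , expansion = congruent (divides (b ^ n * k + k * k * r) (begin
      a ^ suc n - b ^ suc n
        ≡⟨ cong (λ x → x ^ suc n - b ^ suc n) (trans (split a b) (cong (λ x → b + x) a-b≡kN)) ⟩
      (b + k * N) ^ suc n - b ^ suc n
        ≡⟨ cong (_- b ^ suc n) expansion ⟩
      b ^ suc n + N * b ^ n * (k * N) + k * N * (k * N) * r - b ^ suc n
        ≡⟨ lemma (b ^ suc n) (b ^ n) k r N ⟩
      (b ^ n * k + k * k * r) * (N * N) ∎))
    where
    open ≡-Reasoning
    N : ℤ
    N = + suc n
    split : ∀ a b → a ≡ b + (a - b)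
    split = solve-∀
    lemma : ∀ B B′ k r N → B + N * B′ * (k * N) + k * N * (k * N) * r - B ≡ (B′ * k + k * k * r) * (N * N)
    lemma = solve-∀

  binomial-split : ∀ n y → (y + 1ℤ) ^ suc n ≡ y ^ suc n + ∑[ k < n ] (+ (suc n C suc (toℕ k)) * y ^ suc (toℕ k)) + 1ℤ
  binomial-split n y = begin
    (y + 1ℤ) ^ suc n                                      ≡⟨ ^≡^ (y + 1ℤ) (suc n) ⟩
    (y + 1ℤ) Exp.^ suc n                                  ≡⟨ Binomial.theorem (suc n) y 1ℤ ⟩
    T zero + sum (tail T)                                 ≡⟨ cong (λ s → T zero + s) (sum-init-last (tail T)) ⟩
    T zero + (sum (init (tail T)) + last (tail T))        ≡⟨ cong₂ (λ a b → a + (b + last (tail T))) first (sum-cong-≗ inner) ⟩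
    1ℤ + (inner-sum + last (tail T))                      ≡⟨ cong (λ a → 1ℤ + (inner-sum + a)) final ⟩
    1ℤ + (inner-sum + y ^ suc n)                          ≡⟨ rearrange 1ℤ inner-sum (y ^ suc n) ⟩
    y ^ suc n + inner-sum + 1ℤ                            ∎
    where
    open ≡-Reasoning
    T : Fin (suc (suc n)) → ℤ
    T = Binomial.binomialTerm y 1ℤ (suc n)
    inner-sum : ℤ
    inner-sum = ∑[ k < n ] (+ (suc n C suc (toℕ k)) * y ^ suc (toℕ k))
    term : ∀ N k j → (N C k) × (y Exp.^ k * 1ℤ Exp.^ j) ≡ + (N C k) * y ^ k
    term N k j = begin
      (N C k) × (y Exp.^ k * 1ℤ Exp.^ j)     ≡⟨ ×≡* (N C k) _ ⟩
      + (N C k) * (y Exp.^ k * 1ℤ Exp.^ j)   ≡⟨ cong₂ (λ a b → + (N C k) * (a * b)) (sym (^≡^ y k)) (trans (sym (^≡^ 1ℤ j)) (^-zeroˡ j)) ⟩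
      + (N C k) * (y ^ k * 1ℤ)               ≡⟨ cong (+ (N C k) *_) (*-identityʳ (y ^ k)) ⟩
      + (N C k) * y ^ k                      ∎
    first : T zero ≡ 1ℤ
    first = trans (term (suc n) 0 (suc n)) (*-identityˡ 1ℤ)
    inner : ∀ k → init (tail T) k ≡ + (suc n C suc (toℕ k)) * y ^ suc (toℕ k)
    inner k = trans (term (suc n) (suc (toℕ (inject₁ k))) (n ℕ.∸ toℕ (inject₁ k)))
                    (cong (λ i → + (suc n C suc i) * y ^ suc i) (toℕ-inject₁ k))
    final : last (tail T) ≡ y ^ suc n
    final = begin
      last (tail T)                                          ≡⟨ term (suc n) (suc (toℕ (fromℕ n))) (n ℕ.∸ toℕ (fromℕ n)) ⟩
      + (suc n C suc (toℕ (fromℕ n))) * y ^ suc (toℕ (fromℕ n)) ≡⟨ cong (λ i → + (suc n C suc i) * y ^ suc i) (toℕ-fromℕ n) ⟩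
      + (suc n C suc n) * y ^ suc n                          ≡⟨ cong (λ c → + c * y ^ suc n) (nCn≡1 (suc n)) ⟩
      1ℤ * y ^ suc n                                         ≡⟨ *-identityˡ (y ^ suc n) ⟩
      y ^ suc n                                              ∎
    rearrange : ∀ a b c → a + (b + c) ≡ c + b + a
    rearrange = solve-∀


module BinomialCoefficients where

  open Congruences
  open import Data.Fin using (toℕ)
  open import Data.Fin.Properties using (toℕ<n)
  open import Data.Nat as ℕ using (ℕ; zero; suc; s≤s; _<_; _≤_)
  import Data.Nat.Properties as ℕ
  open import Data.Nat.Combinatorics using (_C_; nC1≡n; nCk+nC[k+1]≡[n+1]C[k+1])
  open import Data.Nat.Coprimality using (coprime-divisor; prime⇒coprime)
  open import Data.Nat.Divisibility as ℕ using (divides)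
  open import Data.Nat.Primality using (Prime)
  open import Data.Integer using (ℤ; +_; -_; _+_; _-_; _*_; _^_; 0ℤ; 1ℤ; -1ℤ)
  open import Data.Integer.Properties
  open import Data.Integer.Divisibility.Signed using (∣ᵤ⇒∣)
  open import Data.Integer.Tactic.RingSolver using (solve-∀)
  open import Relation.Binary.PropositionalEquality
  open import Algebra.Properties.Semiring.Sum +-*-semiring using (sum-syntax)

  [k+1]*[n+1]C[k+1]≡[n+1]*nCk : ∀ n k → suc k ℕ.* (suc n C suc k) ≡ suc n ℕ.* (n C k)
  [k+1]*[n+1]C[k+1]≡[n+1]*nCk zero    zero    = refl
  [k+1]*[n+1]C[k+1]≡[n+1]*nCk zero    (suc k) = ℕ.*-zeroʳ (suc (suc k))
  [k+1]*[n+1]C[k+1]≡[n+1]*nCk (suc n) zero    =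
    trans (ℕ.*-identityˡ (suc (suc n) C 1)) (trans (nC1≡n (suc (suc n))) (sym (ℕ.*-identityʳ (suc (suc n)))))
  [k+1]*[n+1]C[k+1]≡[n+1]*nCk (suc n) (suc k) = begin
    suc (suc k) ℕ.* (suc (suc n) C suc (suc k))
      ≡⟨ cong (suc (suc k) ℕ.*_) (sym (nCk+nC[k+1]≡[n+1]C[k+1] (suc n) (suc k))) ⟩
    suc (suc k) ℕ.* (suc n C suc k ℕ.+ suc n C suc (suc k))
      ≡⟨ ℕ.*-distribˡ-+ (suc (suc k)) (suc n C suc k) _ ⟩
    suc n C suc k ℕ.+ suc k ℕ.* (suc n C suc k) ℕ.+ suc (suc k) ℕ.* (suc n C suc (suc k))
      ≡⟨ cong₂ (λ a b → suc n C suc k ℕ.+ a ℕ.+ b) ([k+1]*[n+1]C[k+1]≡[n+1]*nCk n k) ([k+1]*[n+1]C[k+1]≡[n+1]*nCk n (suc k)) ⟩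
    suc n C suc k ℕ.+ suc n ℕ.* (n C k) ℕ.+ suc n ℕ.* (n C suc k)
      ≡⟨ ℕ.+-assoc (suc n C suc k) _ _ ⟩
    suc n C suc k ℕ.+ (suc n ℕ.* (n C k) ℕ.+ suc n ℕ.* (n C suc k))
      ≡⟨ cong (suc n C suc k ℕ.+_) (sym (ℕ.*-distribˡ-+ (suc n) (n C k) (n C suc k))) ⟩
    suc n C suc k ℕ.+ suc n ℕ.* (n C k ℕ.+ n C suc k)
      ≡⟨ cong (λ c → suc n C suc k ℕ.+ suc n ℕ.* c) (nCk+nC[k+1]≡[n+1]C[k+1] n k) ⟩
    suc (suc n) ℕ.* (suc n C suc k) ∎
    where open ≡-Reasoning

  module _ {n : ℕ} (prime : Prime (suc n)) where

    private
      p : ℕ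
      p = suc n
      P : ℤ
      P = + p

    p∣pC[k+1] : ∀ {k} → k < n → p ℕ.∣ p C suc k
    p∣pC[k+1] {k} k<n = coprime-divisor (prime⇒coprime prime (s≤s k<n))
      (divides (n C k) (trans ([k+1]*[n+1]C[k+1]≡[n+1]*nCk n k) (ℕ.*-comm p (n C k))))

    pC[k+1]≡0 : ∀ {k} → k < n → + (p C suc k) ≡ 0ℤ mod P
    pC[k+1]≡0 {k} k<n = ∣⇒≡0-mod {a = + (p C suc k)} (∣ᵤ⇒∣ (p∣pC[k+1] k<n))

    [p-1]Ck≡[-1]^k : ∀ {k} → k ≤ n → + (n C k) ≡ -1ℤ ^ k mod P
    [p-1]Ck≡[-1]^k {zero}  _     = ≡⇒≡-mod refl
    [p-1]Ck≡[-1]^k {suc k} k<n = begin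
      + (n C suc k)                   ≡⟨ pascal ⟩
      + (p C suc k) - + (n C k)       ≈⟨ +-cong-mod (pC[k+1]≡0 k<n) (-‿cong-mod ([p-1]Ck≡[-1]^k (ℕ.<⇒≤ k<n))) ⟩
      0ℤ - -1ℤ ^ k                    ≡⟨ lemma (-1ℤ ^ k) ⟩
      -1ℤ ^ suc k                     ∎
      where
      open ≡-mod-Reasoning P
      lemma : ∀ e → 0ℤ - e ≡ -1ℤ * e
      lemma = solve-∀
      a+b-a≡b : ∀ a b → a + b - a ≡ b
      a+b-a≡b = solve-∀
      pascal : + (n C suc k) ≡ + (p C suc k) - + (n C k)
      pascal = trans (sym (a+b-a≡b (+ (n C k)) (+ (n C suc k))))
                     (cong (λ c → + c - + (n C k)) (nCk+nC[k+1]≡[n+1]C[k+1] n k))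

    pC[k+1]≡p[-1]^k/[k+1] : ∀ {k v} → k < n → + suc k * v ≡ 1ℤ mod P → + (p C suc k) ≡ P * (-1ℤ ^ k * v) mod P * P
    pC[k+1]≡p[-1]^k/[k+1] {k} {v} k<n jv≡1 = begin
      c
        ≡⟨ sym (lemma c j v) ⟩
      c * (1ℤ - j * v) + v * (j * c)
        ≡⟨ cong (λ z → c * (1ℤ - j * v) + v * z) absorption ⟩
      c * (1ℤ - j * v) + v * (P * c′)
        ≈⟨ +-cong-mod (*-≡0-mod (pC[k+1]≡0 k<n) 1-jv≡0) (*-congˡ-mod v (≡-mod-scale P ([p-1]Ck≡[-1]^k (ℕ.<⇒≤ k<n)))) ⟩
      0ℤ + v * (P * -1ℤ ^ k)
        ≡⟨ lemma′ v P (-1ℤ ^ k) ⟩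
      P * (-1ℤ ^ k * v) ∎
      where
      open ≡-mod-Reasoning (P * P)
      c : ℤ
      c = + (p C suc k)
      c′ : ℤ
      c′ = + (n C k)
      j : ℤ
      j = + suc k
      lemma : ∀ a b x → a * (1ℤ - b * x) + x * (b * a) ≡ a
      lemma = solve-∀
      lemma′ : ∀ x a e → 0ℤ + x * (a * e) ≡ a * (e * x)
      lemma′ = solve-∀
      absorption : j * c ≡ P * c′
      absorption = trans (sym (pos-* (suc k) (p C suc k))) (trans (cong +_ ([k+1]*[n+1]C[k+1]≡[n+1]*nCk n k)) (pos-* p (n C k)))
      1-jv≡0 : 1ℤ - j * v ≡ 0ℤ mod P
      1-jv≡0 = ∣⇒≡0-mod (_≡_mod_.n∣a-b (≡-mod-sym jv≡1))

    fermat : ∀ x → (+ x) ^ p ≡ + x mod P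
    fermat zero    = ≡⇒≡-mod (*-zeroˡ (0ℤ ^ n))
    fermat (suc x) = begin
      (1ℤ + + x) ^ p                                                      ≡⟨ cong (_^ p) (+-comm 1ℤ (+ x)) ⟩
      (+ x + 1ℤ) ^ p                                                      ≡⟨ binomial-split n (+ x) ⟩
      (+ x) ^ p + ∑[ k < n ] (+ (p C suc (toℕ k)) * (+ x) ^ suc (toℕ k)) + 1ℤ ≈⟨ +-congʳ-mod 1ℤ (+-cong-mod (fermat x) inner≡0) ⟩
      + x + 0ℤ + 1ℤ                                                        ≡⟨ cong (_+ 1ℤ) (+-identityʳ (+ x)) ⟩
      + x + 1ℤ                                                             ≡⟨ +-comm (+ x) 1ℤ ⟩
      1ℤ + + x                                                             ∎
      where
      open ≡-mod-Reasoning P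
      inner≡0 : ∑[ k < n ] (+ (p C suc (toℕ k)) * (+ x) ^ suc (toℕ k)) ≡ 0ℤ mod P
      inner≡0 = ∑-≡0-mod _ λ k →
        ≡-mod-trans (*-congʳ-mod ((+ x) ^ suc (toℕ k)) (pC[k+1]≡0 (toℕ<n k)))
                    (≡⇒≡-mod (*-zeroˡ ((+ x) ^ suc (toℕ k))))

    fermat-unit : ∀ {x} → 0 < x → x < p → (+ x) ^ n ≡ 1ℤ mod P
    fermat-unit {x} 0<x x<p = *-cancelˡ-≡-mod {x = + x} (prime⇒coprime prime {{ℕ.>-nonZero 0<x}} x<p)
      (≡-mod-trans (fermat x) (≡⇒≡-mod (sym (*-identityʳ (+ x)))))


module MirimanoffCriterion where

  open Congruences
  open BinomialCoefficients
  open import Data.Fin using (Fin; toℕ)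
  open import Data.Fin.Properties using (toℕ<n)
  open import Data.Nat as ℕ using (ℕ; suc; _<_; _≤_)
  open import Data.Nat.Combinatorics using (_C_)
  open import Data.Nat.Primality using (Prime)
  open import Data.Integer using (ℤ; +_; -_; _+_; _-_; _*_; _^_; 0ℤ; 1ℤ; -1ℤ)
  open import Data.Integer.Properties
  open import Data.Integer.Coprimality using (Coprime)
  open import Data.Integer.Tactic.RingSolver using (solve-∀)
  open import Relation.Binary.PropositionalEquality
  open import Algebra.Properties.Semiring.Sum +-*-semiring using (sum-syntax; *-distribˡ-sum)

  -- x ^ p ≡ x (mod p²): for p ∤ x this says q_p(x) = 0, and unlike x ^ (p - 1) ≡ 1 it is
  -- closed under products and, for odd p, under negation.
  Wieferich : ℕ → ℤ → Set
  Wieferich p x = x ^ p ≡ x mod + p * + p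

  WieferichUpTo : ℕ → ℕ → Set
  WieferichUpTo p m = ∀ {j} → j ≤ m → Wieferich p (+ j)

  wieferich-0 : ∀ n → Wieferich (suc n) 0ℤ
  wieferich-0 n = ≡⇒≡-mod (*-zeroˡ (0ℤ ^ n))

  wieferich-* : ∀ {p x y} → Wieferich p x → Wieferich p y → Wieferich p (x * y)
  wieferich-* {p} {x} {y} wx wy = ≡-mod-trans (≡⇒≡-mod (^-distribʳ-* x y p)) (*-cong-mod wx wy)

  wieferich-neg : ∀ {k x} → Wieferich (suc (k ℕ.* 2)) x → Wieferich (suc (k ℕ.* 2)) (- x)
  wieferich-neg {k} {x} wx = ≡-mod-trans (≡⇒≡-mod (neg-^-odd x k)) (-‿cong-mod wx)

  module _ {n : ℕ} where

    private
      p : ℕ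
      p = suc n
      P : ℤ
      P = + p

    fraction-criterion : ∀ {a b c} → Wieferich p a → Wieferich p b → Wieferich p (b - a) →
                         c * b ≡ a mod P → Coprime P b → (1ℤ - c) ^ p + c ^ p ≡ 1ℤ mod P * P
    fraction-criterion {a} {b} {c} wa wb wb-a cb≡a P⊥b = *-cancelˡ-≡-mod-square {P} {b} P⊥b (begin
      b * X                                 ≈⟨ *-congʳ-mod X (≡-mod-sym wb) ⟩
      b ^ p * X                             ≡⟨ distribute ⟩
      (b * (1ℤ - c)) ^ p + (c * b) ^ p      ≈⟨ +-cong-mod (^-cong-mod-square p b[1-c]≡b-a) (^-cong-mod-square p cb≡a) ⟩
      (b - a) ^ p + a ^ p                   ≈⟨ +-cong-mod wb-a wa ⟩
      b - a + a                             ≡⟨ lemma b a ⟩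
      b * 1ℤ                                ∎)
      where
      open ≡-mod-Reasoning (P * P)
      X : ℤ
      X = (1ℤ - c) ^ p + c ^ p
      distribute : b ^ p * X ≡ (b * (1ℤ - c)) ^ p + (c * b) ^ p
      distribute = trans (*-distribˡ-+ (b ^ p) _ _)
        (sym (cong₂ _+_ (^-distribʳ-* b (1ℤ - c) p) (trans (^-distribʳ-* c b p) (*-comm (c ^ p) (b ^ p)))))
      b[1-c]≡b-a : b * (1ℤ - c) ≡ b - a mod P
      b[1-c]≡b-a = ≡-mod-trans (≡⇒≡-mod (lemma′ b c)) (+-congˡ-mod b (-‿cong-mod cb≡a))
        where
        lemma′ : ∀ b c → b * (1ℤ - c) ≡ b - c * b
        lemma′ = solve-∀
      lemma : ∀ b a → b - a + a ≡ b * 1ℤ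
      lemma = solve-∀

    fraction-injective : ∀ {a b a′ b′ c} → c * b ≡ a mod P → c * b′ ≡ a′ mod P →
                         Wieferich p (a * b′) → Wieferich p (a′ * b) → a * b′ ≡ a′ * b mod P * P
    fraction-injective {a} {b} {a′} {b′} {c} cb≡a cb′≡a′ wab′ wa′b = begin
      a * b′          ≈⟨ ≡-mod-sym wab′ ⟩
      (a * b′) ^ p    ≈⟨ ^-cong-mod-square p ab′≡a′b ⟩
      (a′ * b) ^ p    ≈⟨ wa′b ⟩
      a′ * b          ∎
      where
      open ≡-mod-Reasoning (P * P)
      ab′≡a′b : a * b′ ≡ a′ * b mod P
      ab′≡a′b = ≡-mod-trans (*-congʳ-mod b′ (≡-mod-sym cb≡a))
                (≡-mod-trans (≡⇒≡-mod (lemma c b b′)) (*-congʳ-mod b cb′≡a′))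
        where
        lemma : ∀ c b b′ → c * b * b′ ≡ c * b′ * b
        lemma = solve-∀

  module _ {k : ℕ} (prime : Prime (suc (k ℕ.* 2))) where

    private
      n : ℕ
      n = k ℕ.* 2
      p : ℕ
      p = suc n
      P : ℤ
      P = + p

    fermat-sum-expansion : ∀ c → (1ℤ - c) ^ p + c ^ p ≡ ∑[ j < n ] (+ (p C suc (toℕ j)) * (- c) ^ suc (toℕ j)) + 1ℤ
    fermat-sum-expansion c = begin
      (1ℤ - c) ^ p + c ^ p          ≡⟨ cong (λ z → z ^ p + c ^ p) (+-comm 1ℤ (- c)) ⟩
      (- c + 1ℤ) ^ p + c ^ p        ≡⟨ cong (_+ c ^ p) (binomial-split n (- c)) ⟩
      (- c) ^ p + S + 1ℤ + c ^ p    ≡⟨ cong (λ z → z + S + 1ℤ + c ^ p) (neg-^-odd c k) ⟩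
      - c ^ p + S + 1ℤ + c ^ p      ≡⟨ lemma (c ^ p) S ⟩
      S + 1ℤ                        ∎
      where
      open ≡-Reasoning
      S : ℤ
      S = ∑[ j < n ] (+ (p C suc (toℕ j)) * (- c) ^ suc (toℕ j))
      lemma : ∀ x s → - x + s + 1ℤ + x ≡ s + 1ℤ
      lemma = solve-∀

    binomial-term≡ : ∀ {j v} c → j < n → + suc j * v ≡ 1ℤ mod P →
              + (p C suc j) * (- c) ^ suc j ≡ P * (-1ℤ * (c ^ suc j * v)) mod P * P
    binomial-term≡ {j} {v} c j<n jv≡1 = begin
      + (p C suc j) * (- c) ^ suc j                      ≈⟨ *-congʳ-mod ((- c) ^ suc j) (pC[k+1]≡p[-1]^k/[k+1] prime j<n jv≡1) ⟩
      P * (e * v) * (- c) ^ suc j                        ≡⟨ cong (λ z → P * (e * v) * z) (neg-^ c (suc j)) ⟩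
      P * (e * v) * (-1ℤ * e * c ^ suc j)                ≡⟨ lemma P e v (c ^ suc j) ⟩
      P * (-1ℤ * (c ^ suc j * v)) * (e * e)              ≡⟨ cong (λ z → P * (-1ℤ * (c ^ suc j * v)) * z) (-1^-square j) ⟩
      P * (-1ℤ * (c ^ suc j * v)) * 1ℤ                   ≡⟨ *-identityʳ _ ⟩
      P * (-1ℤ * (c ^ suc j * v))                        ∎
      where
      open ≡-mod-Reasoning (P * P)
      e : ℤ
      e = -1ℤ ^ j
      lemma : ∀ P e v x → P * (e * v) * (-1ℤ * e * x) ≡ P * (-1ℤ * (x * v)) * (e * e)
      lemma = solve-∀

    mirimanoff-criterion : (v : ℕ → ℤ) → (∀ {j} → j < n → + suc j * v (suc j) ≡ 1ℤ mod P) →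
                           ∀ c → (1ℤ - c) ^ p + c ^ p ≡ 1ℤ mod P * P →
                           ∑[ j < n ] (c ^ suc (toℕ j) * v (suc (toℕ j))) ≡ 0ℤ mod P
    mirimanoff-criterion v inverse c fermat-sum≡1 = begin
      T                      ≡⟨ lemma T ⟩
      -1ℤ * (-1ℤ * T)        ≈⟨ *-congˡ-mod -1ℤ (≡-mod-unscale P PT≡0) ⟩
      -1ℤ * 0ℤ               ≡⟨⟩
      0ℤ                     ∎
      where
      open ≡-mod-Reasoning P
      lemma : ∀ t → t ≡ -1ℤ * (-1ℤ * t)
      lemma = solve-∀
      t : Fin n → ℤ
      t j = c ^ suc (toℕ j) * v (suc (toℕ j))
      T : ℤ
      T = ∑[ j < n ] t j
      S : ℤ
      S = ∑[ j < n ] (+ (p C suc (toℕ j)) * (- c) ^ suc (toℕ j))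
      S≡0 : S ≡ 0ℤ mod P * P
      S≡0 = +-cancelʳ-≡-mod 1ℤ (≡-mod-trans (≡⇒≡-mod (sym (fermat-sum-expansion c))) fermat-sum≡1)
      term : ∀ j → + (p C suc (toℕ j)) * (- c) ^ suc (toℕ j) ≡ P * (-1ℤ * t j) mod P * P
      term j = binomial-term≡ c (toℕ<n j) (inverse (toℕ<n j))
      S≡PT : S ≡ P * (-1ℤ * T) mod P * P
      S≡PT = ≡-mod-trans (∑-cong-mod _ _ term)
               (≡⇒≡-mod (trans (sym (*-distribˡ-sum P (λ j → -1ℤ * t j))) (cong (P *_) (sym (*-distribˡ-sum -1ℤ t)))))
      PT≡0 : P * (-1ℤ * T) ≡ P * 0ℤ mod P * P
      PT≡0 = ≡-mod-trans (≡-mod-sym S≡PT) (≡-mod-trans S≡0 (≡⇒≡-mod (sym (*-zeroʳ P))))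


module Computations where

  open Congruences
  open BinomialCoefficients
  open MirimanoffCriterion
  open import Data.Bool using (Bool; true; false)
  open import Data.Empty using (⊥-elim)
  open import Data.Sum using (inj₁; inj₂)
  open import Function using (case_of_)
  open import Data.Nat as ℕ using (ℕ; zero; suc; _∸_; _≤_; _<_; z≤n; _≟_)
  import Data.Nat.Properties as ℕ
  open import Relation.Binary.PropositionalEquality
  open import Data.Nat.DivMod using (_%_; _/_; m≡m%n+[m/n]*n; m*[n/m]≡n; m<n⇒m%n≡m; %-distribˡ-*; m%n%n≡m%n; [m+kn]%n≡m%n; m%n<n)
  open import Data.Nat.Primality using (Prime; prime⇒nonTrivial)
  open import Data.Nat.Base using (nonTrivial⇒n>1)
  open import Data.Bool using (T; not; _∧_)
  open import Data.Bool.Properties using (∧-zeroʳ; T-≡)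
  open import Data.Unit using (tt)
  open import Data.Fin using (toℕ)
  open import Data.List using (map; applyUpTo)
  open import Data.Nat.ListAction using (sum)
  open import Relation.Nullary using (yes; no)
  open import Relation.Nullary.Decidable using (⌊_⌋; toWitness; fromWitness)
  open import Function.Bundles using (Equivalence)
  open import Data.Integer using (ℤ; +_; -_; _+_; _-_; _*_; _^_; _⊖_; ∣_∣; 0ℤ; 1ℤ)
  open import Data.Integer.Properties using (+-*-semiring; pos-+; pos-*; +-injective; i-j≡0⇒i≡j; m-n≡m⊖n; ∣i∣≡0⇒i≡0; ∣m⊝n∣≤m⊔n; ⊖-≥; *-identityʳ)
  open import Data.Nat.Divisibility as ℕ using (>⇒∤; m%n≡0⇒n∣m; n∣m⇒m%n≡0; divides)
  open import Algebra.Properties.Semiring.Sum +-*-semiring using (sum-syntax; sum-cong-≗)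
  open import Data.Integer.Divisibility.Signed using (_∣_; divides; ∣⇒∣ᵤ; ∣ᵤ⇒∣)
  open import Data.Integer.Tactic.RingSolver using (solve-∀)

  module _ (P : ℕ → Bool) where

    firstFrom-≥ : ∀ s f → s ≤ firstFrom P s f
    firstFrom-≥ s zero = ℕ.≤-refl
    firstFrom-≥ s (suc f) with P s
    ... | true  = ℕ.≤-refl
    ... | false = ℕ.<⇒≤ (firstFrom-≥ (suc s) f)

    firstFrom-≤ : ∀ s f → firstFrom P s f ≤ s ℕ.+ f
    firstFrom-≤ s zero = ℕ.≤-reflexive (sym (ℕ.+-identityʳ s))
    firstFrom-≤ s (suc f) with P s
    ... | true  = ℕ.m≤m+n s (suc f)
    ... | false = ℕ.≤-trans (firstFrom-≤ (suc s) f) (ℕ.≤-reflexive (sym (ℕ.+-suc s f)))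

    firstFrom-minimal : ∀ s f {m} → s ≤ m → m < firstFrom P s f → P m ≡ false
    firstFrom-minimal s zero    s≤m m<s = ⊥-elim (ℕ.<⇒≱ m<s s≤m)
    firstFrom-minimal s (suc f) {m} s≤m m<first with P s in Ps
    ... | true  = ⊥-elim (ℕ.<⇒≱ m<first s≤m)
    ... | false with ℕ.m≤n⇒m<n∨m≡n s≤m
    ...   | inj₁ s<m  = firstFrom-minimal (suc s) f s<m m<first
    ...   | inj₂ refl = Ps

    firstFrom-found : ∀ s f {m} → s ≤ m → m < s ℕ.+ f → P m ≡ true → P (firstFrom P s f) ≡ true
    firstFrom-found s zero    s≤m m<s+0 _ = ⊥-elim (ℕ.<⇒≱ m<s+0 (subst (_≤ _) (sym (ℕ.+-identityʳ s)) s≤m))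
    firstFrom-found s (suc f) {m} s≤m m<s+f Pm with P s in Ps
    ... | true  = Ps
    ... | false with ℕ.m≤n⇒m<n∨m≡n s≤m
    ...   | inj₁ s<m  = firstFrom-found (suc s) f s<m (subst (m <_) (ℕ.+-suc s f) m<s+f) Pm
    ...   | inj₂ refl = case (trans (sym Ps) Pm) of λ ()

    firstFrom-skip : ∀ s f → P s ≡ false → suc s ≤ firstFrom P s (suc f)
    firstFrom-skip s f Ps≡false rewrite Ps≡false = firstFrom-≥ (suc s) f

  %≡%⇒≡-mod : ∀ {a b n} .{{_ : ℕ.NonZero n}} → a % n ≡ b % n → + a ≡ + b mod + n
  %≡%⇒≡-mod {a} {b} {n} a%n≡b%n = congruent (divides (+ (a / n) - + (b / n)) (begin
    + a - + b
      ≡⟨ cong₂ (λ x y → + x - + y) (m≡m%n+[m/n]*n a n) (m≡m%n+[m/n]*n b n) ⟩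
    + (a % n ℕ.+ a / n ℕ.* n) - + (b % n ℕ.+ b / n ℕ.* n)
      ≡⟨ cong (λ r → + (a % n ℕ.+ a / n ℕ.* n) - + (r ℕ.+ b / n ℕ.* n)) (sym a%n≡b%n) ⟩
    + (a % n ℕ.+ a / n ℕ.* n) - + (a % n ℕ.+ b / n ℕ.* n)
      ≡⟨ cong₂ (λ x y → x - y) (pos-+-* (a % n) (a / n) n) (pos-+-* (a % n) (b / n) n) ⟩
    + (a % n) + + (a / n) * + n - (+ (a % n) + + (b / n) * + n)
      ≡⟨ lemma (+ (a % n)) (+ (a / n)) (+ (b / n)) (+ n) ⟩
    (+ (a / n) - + (b / n)) * + n ∎))
    where
    open ≡-Reasoning
    pos-+-* : ∀ r q n → + (r ℕ.+ q ℕ.* n) ≡ + r + + q * + n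
    pos-+-* r q n = trans (pos-+ r (q ℕ.* n)) (cong (λ z → + r + z) (pos-* q n))
    lemma : ∀ r x y n → r + x * n - (r + y * n) ≡ (x - y) * n
    lemma = solve-∀

  ≡-mod-<⇒≡ : ∀ {x y N} → + x ≡ + y mod + N → x < N → y < N → x ≡ y
  ≡-mod-<⇒≡ {x} {y} {N} (congruent N∣x-y) x<N y<N = +-injective (i-j≡0⇒i≡j (+ x) (+ y) (∣i∣≡0⇒i≡0 ∣x-y∣≡0))
    where
    ∣x-y∣<N : ∣ + x - + y ∣ < N
    ∣x-y∣<N = subst (_< N) (cong ∣_∣ (sym (m-n≡m⊖n x y))) (ℕ.≤-<-trans (∣m⊝n∣≤m⊔n x y) (ℕ.⊔-lub x<N y<N))
    ∣x-y∣≡0 : ∣ + x - + y ∣ ≡ 0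
    ∣x-y∣≡0 with ∣ + x - + y ∣ in eq
    ... | zero  = refl
    ... | suc _ = ⊥-elim (>⇒∤ (subst (_< N) eq ∣x-y∣<N) (subst (N ℕ.∣_) eq (∣⇒∣ᵤ N∣x-y)))

  module _ {n : ℕ} (prime : Prime (suc n)) where

    private
      p : ℕ
      p = suc n
      P : ℤ
      P = + p

    [+j]^n-1≡+[j^n∸1] : ∀ {j} → 0 < j → (+ j) ^ n - 1ℤ ≡ + (j ℕ.^ n ∸ 1)
    [+j]^n-1≡+[j^n∸1] {j} 0<j = begin
      (+ j) ^ n - 1ℤ       ≡⟨ cong (_- 1ℤ) (sym (pos-^ j n)) ⟩
      + (j ℕ.^ n) - 1ℤ     ≡⟨ m-n≡m⊖n (j ℕ.^ n) 1 ⟩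
      j ℕ.^ n ⊖ 1          ≡⟨ ⊖-≥ (ℕ.m^n>0 j {{ℕ.>-nonZero 0<j}} n) ⟩
      + (j ℕ.^ n ∸ 1)      ∎
      where open ≡-Reasoning

    p∣j^n-1 : ∀ {j} → 0 < j → j < p → p ℕ.∣ j ℕ.^ n ∸ 1
    p∣j^n-1 0<j j<p = ∣⇒∣ᵤ (subst (P ∣_) ([+j]^n-1≡+[j^n∸1] 0<j) (_≡_mod_.n∣a-b (fermat-unit prime 0<j j<p)))

    fermatQuotient≡0⇒wieferich : ∀ {j} → 0 < j → j < p → fermatQuotient p j ≡ 0 → Wieferich p (+ j)
    fermatQuotient≡0⇒wieferich {j} 0<j j<p q≡0 = begin
      (+ j) * (+ j) ^ n   ≈⟨ *-congˡ-mod (+ j) j^n≡1 ⟩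
      (+ j) * 1ℤ          ≡⟨ *-identityʳ (+ j) ⟩
      + j                 ∎
      where
      open ≡-mod-Reasoning (P * P)
      N : ℕ
      N = j ℕ.^ n ∸ 1
      pp∣N : p ℕ.* p ℕ.∣ N
      pp∣N = subst (p ℕ.* p ℕ.∣_) (m*[n/m]≡n (p∣j^n-1 0<j j<p)) (ℕ.*-monoʳ-∣ p (m%n≡0⇒n∣m (N / p) p q≡0))
      j^n≡1 : (+ j) ^ n ≡ 1ℤ mod P * P
      j^n≡1 = congruent (subst₂ _∣_ (pos-* p p) (sym ([+j]^n-1≡+[j^n∸1] 0<j)) (∣ᵤ⇒∣ pp∣N))

    private
      0<n : 0 < n
      0<n = ℕ.s≤s⁻¹ (nonTrivial⇒n>1 p {{prime⇒nonTrivial prime}})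

    1%p≡1 : 1 % p ≡ 1
    1%p≡1 = m<n⇒m%n≡m (nonTrivial⇒n>1 p {{prime⇒nonTrivial prime}})

    j^[n-1]-inverse : ∀ {j} → 0 < j → j < p → (j ℕ.^ (n ∸ 1) % p ℕ.* j) % p ≡ 1
    j^[n-1]-inverse {j} 0<j j<p = begin-equality
      (j ℕ.^ (n ∸ 1) % p ℕ.* j) % p
        ≡⟨ %-distribˡ-* (j ℕ.^ (n ∸ 1) % p) j p ⟩
      (j ℕ.^ (n ∸ 1) % p % p ℕ.* (j % p)) % p
        ≡⟨ cong (λ x → (x ℕ.* (j % p)) % p) (m%n%n≡m%n (j ℕ.^ (n ∸ 1)) p) ⟩
      (j ℕ.^ (n ∸ 1) % p ℕ.* (j % p)) % p
        ≡⟨ sym (%-distribˡ-* (j ℕ.^ (n ∸ 1)) j p) ⟩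
      (j ℕ.^ (n ∸ 1) ℕ.* j) % p
        ≡⟨ cong (_% p) (trans (ℕ.*-comm _ j) (cong (j ℕ.^_) (ℕ.suc-pred n {{ℕ.>-nonZero 0<n}}))) ⟩
      j ℕ.^ n % p
        ≡⟨ cong (_% p) (sym (ℕ.m+[n∸m]≡n (ℕ.m^n>0 j {{ℕ.>-nonZero 0<j}} n))) ⟩
      (1 ℕ.+ (j ℕ.^ n ∸ 1)) % p
        ≡⟨ cong (λ x → (1 ℕ.+ x) % p) N≡qp ⟩
      (1 ℕ.+ q ℕ.* p) % p
        ≡⟨ [m+kn]%n≡m%n 1 q p ⟩
      1 % p
        ≡⟨ 1%p≡1 ⟩
      1 ∎
      where
      open ℕ.≤-Reasoning
      q : ℕ
      q = ℕ.quotient (p∣j^n-1 0<j j<p)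
      N≡qp : j ℕ.^ n ∸ 1 ≡ q ℕ.* p
      N≡qp = ℕ._∣_.equality (p∣j^n-1 0<j j<p)

    invMod-inverse : ∀ {j} → 0 < j → j < p → + j * + invMod p j ≡ 1ℤ mod P
    invMod-inverse {j} 0<j j<p = begin
      + j * + invMod p j      ≡⟨ trans (sym (pos-* j (invMod p j))) (cong +_ (ℕ.*-comm j (invMod p j))) ⟩
      + (invMod p j ℕ.* j)    ≈⟨ %≡%⇒≡-mod (trans found (sym 1%p≡1)) ⟩
      1ℤ                      ∎
      where
      open ≡-mod-Reasoning P
      Q : ℕ → Bool
      Q i = ⌊ (i ℕ.* j) % p ≟ 1 ⌋
      found : (invMod p j ℕ.* j) % p ≡ 1
      found = toWitness (subst T (sym (firstFrom-found Q 0 p z≤n (m%n<n (j ℕ.^ (n ∸ 1)) p) witness)) tt)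
        where
        witness : Q (j ℕ.^ (n ∸ 1) % p) ≡ true
        witness = Equivalence.to T-≡ (fromWitness (j^[n-1]-inverse 0<j j<p))

    qNonzero≡false⇒q≡0 : ∀ {j} → 0 < j → j < p →
                       not ⌊ p ℕ.∣? j ⌋ ∧ not ⌊ fermatQuotient p j ≟ 0 ⌋ ≡ false → fermatQuotient p j ≡ 0
    qNonzero≡false⇒q≡0 {j} 0<j j<p qNonzero≡false with p ℕ.∣? j | fermatQuotient p j ≟ 0
    ... | yes p∣j | _       = ⊥-elim (>⇒∤ {{ℕ.>-nonZero 0<j}} j<p p∣j)
    ... | no _    | yes q≡0 = q≡0
    ... | no _    | no _    = case qNonzero≡false of λ ()

    2≤kappa : 2 ≤ kappa p
    2≤kappa = firstFrom-skip (qNonzero p) 1 p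
      (trans (cong (λ x → not ⌊ p ℕ.∣? 1 ⌋ ∧ not ⌊ ((x ∸ 1) / p) % p ≟ 0 ⌋) (ℕ.^-zeroˡ n)) (∧-zeroʳ _))

    kappa≤p+2 : kappa p ≤ p ℕ.+ 2
    kappa≤p+2 = subst (kappa p ≤_) (ℕ.+-comm 2 p) (firstFrom-≤ (qNonzero p) 1 (suc p))

    wieferich-below-kappa : ∀ {j} → 0 < j → j < kappa p → j < p → Wieferich p (+ j)
    wieferich-below-kappa 0<j j<κ j<p = fermatQuotient≡0⇒wieferich 0<j j<p
      (qNonzero≡false⇒q≡0 0<j j<p (firstFrom-minimal (qNonzero p) 1 (suc p) 0<j j<κ))

  sum-map-applyUpTo : ∀ (h f : ℕ → ℕ) m → + sum (map h (applyUpTo f m)) ≡ ∑[ i < m ] (+ h (f (toℕ i)))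
  sum-map-applyUpTo h f zero    = refl
  sum-map-applyUpTo h f (suc m) = cong (λ s → + h (f 0) + s) (sum-map-applyUpTo h (λ i → f (suc i)) m)

  module _ {n : ℕ} where

    private
      p : ℕ
      p = suc n
      P : ℤ
      P = + p

    mirimanoff≡0 : ∀ c → ∑[ j < n ] ((+ c) ^ suc (toℕ j) * + invMod p (suc (toℕ j))) ≡ 0ℤ mod P →
                   mirimanoff p c ≡ 0
    mirimanoff≡0 c ∑≡0 = n∣m⇒m%n≡0 _ p (∣⇒∣ᵤ (subst (P ∣_) (sym cast) (≡0-mod⇒∣ ∑≡0)))
      where
      h : ℕ → ℕ
      h j = c ℕ.^ j ℕ.* invMod p j
      cast : + sum (map h (applyUpTo suc n)) ≡ ∑[ j < n ] ((+ c) ^ suc (toℕ j) * + invMod p (suc (toℕ j)))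
      cast = trans (sum-map-applyUpTo h suc n)
                   (sum-cong-≗ {n} λ j → trans (pos-* (c ℕ.^ suc (toℕ j)) (invMod p (suc (toℕ j))))
                                               (cong (_* + invMod p (suc (toℕ j))) (pos-^ c (suc (toℕ j)))))


module Fractions where

  open Congruences
  open MirimanoffCriterion
  open Computations
  open import Data.Nat as ℕ using (ℕ; suc; _≤_; _<_; z≤n; s≤s)
  import Data.Nat.Properties as ℕ
  open import Data.Nat.Coprimality using (Coprime; coprime-divisor; prime⇒coprime)
  open import Data.Nat.Divisibility as ℕ using (divides)
  open import Data.Nat.DivMod using (_%_; m%n%n≡m%n; m%n<n)
  open import Data.Nat.Primality using (Prime)
  open import Data.Integer using (ℤ; +_; -_; _+_; _-_; _*_; _^_; _⊖_; 1ℤ)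
  open import Data.Integer.Properties using (pos-*; m-n≡m⊖n; ⊖-≥; ⊖-swap; *-identityʳ)
  open import Data.Integer.Tactic.RingSolver using (solve-∀)
  open import Data.Product using (_×_; _,_)
  open import Data.Sum using (inj₁; inj₂)
  open import Relation.Binary.PropositionalEquality

  coprime-cross-multiplication : ∀ {a b a′ b′} → Coprime a b → Coprime a′ b′ → 0 < a →
                                 a ℕ.* b′ ≡ a′ ℕ.* b → a ≡ a′ × b ≡ b′
  coprime-cross-multiplication {a} {b} {a′} {b′} a⊥b a′⊥b′ 0<a ab′≡a′b = a≡a′ , b≡b′
    where
    a≡a′ : a ≡ a′
    a≡a′ = ℕ.∣-antisym (coprime-divisor a⊥b (divides b′ (trans (ℕ.*-comm b a′) (trans (sym ab′≡a′b) (ℕ.*-comm a b′)))))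
                       (coprime-divisor a′⊥b′ (divides b (trans (ℕ.*-comm b′ a) (trans ab′≡a′b (ℕ.*-comm a′ b)))))
    b≡b′ : b ≡ b′
    b≡b′ = ℕ.*-cancelˡ-≡ b b′ a {{ℕ.>-nonZero 0<a}} (trans (cong (ℕ._* b) a≡a′) (sym ab′≡a′b))

  fraction : (p a b : ℕ) .{{_ : ℕ.NonZero p}} → ℕ
  fraction p a b = (a ℕ.* invMod p b) % p

  fraction<p : ∀ p a b .{{_ : ℕ.NonZero p}} → fraction p a b < p
  fraction<p p a b = m%n<n (a ℕ.* invMod p b) p

  module _ {n : ℕ} (prime : Prime (suc n)) where

    private
      p : ℕ
      p = suc n
      P : ℤ
      P = + p

    fraction*b≡a : ∀ {a b} → 0 < b → b < p → + fraction p a b * + b ≡ + a mod P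
    fraction*b≡a {a} {b} 0<b b<p = begin
      + fraction p a b * + b
        ≈⟨ *-congʳ-mod (+ b) (%≡%⇒≡-mod {(a ℕ.* invMod p b) % p} {a ℕ.* invMod p b} (m%n%n≡m%n (a ℕ.* invMod p b) p)) ⟩
      + (a ℕ.* invMod p b) * + b
        ≡⟨ trans (cong (_* + b) (pos-* a (invMod p b))) (lemma (+ a) (+ invMod p b) (+ b)) ⟩
      + a * (+ b * + invMod p b)
        ≈⟨ *-congˡ-mod (+ a) (invMod-inverse prime 0<b b<p) ⟩
      + a * 1ℤ
        ≡⟨ *-identityʳ (+ a) ⟩
      + a ∎
      where
      open ≡-mod-Reasoning P
      lemma : ∀ a v b → a * v * b ≡ a * (b * v)
      lemma = solve-∀

  module _ {k : ℕ} (prime : Prime (suc (k ℕ.* 2))) where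

    private
      n : ℕ
      n = k ℕ.* 2
      p : ℕ
      p = suc n
      P : ℤ
      P = + p

    wieferich-difference : ∀ {m a b} → WieferichUpTo p m → a ≤ m → b ≤ m →
                           Wieferich p (+ b - + a)
    wieferich-difference {m} {a} {b} w a≤m b≤m with ℕ.≤-total a b
    ... | inj₁ a≤b = subst (Wieferich p) (sym (trans (m-n≡m⊖n b a) (⊖-≥ a≤b)))
                           (w (ℕ.≤-trans (ℕ.m∸n≤m b a) b≤m))
    ... | inj₂ b≤a = subst (Wieferich p) (sym (trans (m-n≡m⊖n b a) (trans (⊖-swap b a) (cong -_ (⊖-≥ b≤a)))))
                           (wieferich-neg {k} (w (ℕ.≤-trans (ℕ.m∸n≤m a b) a≤m)))

    mirimanoff[fraction]≡0 : ∀ {m a b} → m < p → WieferichUpTo p m →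
                          a ≤ m → 0 < b → b ≤ m → mirimanoff p (fraction p a b) ≡ 0
    mirimanoff[fraction]≡0 {m} {a} {b} m<p w a≤m 0<b b≤m =
      mirimanoff≡0 {n} (fraction p a b) (mirimanoff-criterion {k} prime (λ j → + invMod p j) inverse (+ fraction p a b) fermat-sum≡1)
      where
      b<p : b < p
      b<p = ℕ.≤-<-trans b≤m m<p
      inverse : ∀ {j} → j < n → + suc j * + invMod p (suc j) ≡ 1ℤ mod P
      inverse j<n = invMod-inverse prime (s≤s z≤n) (s≤s j<n)
      fermat-sum≡1 : (1ℤ - + fraction p a b) ^ p + (+ fraction p a b) ^ p ≡ 1ℤ mod P * P
      fermat-sum≡1 = fraction-criterion {n} {+ a} {+ b} {+ fraction p a b} (w a≤m) (w b≤m) (wieferich-difference w a≤m b≤m)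
                       (fraction*b≡a prime 0<b b<p) (prime⇒coprime prime {{ℕ.>-nonZero 0<b}} b<p)

    fraction-injective-on-coprime : ∀ {m a b a′ b′} → m < p → WieferichUpTo p m →
      0 < a → a ≤ m → 0 < b → b ≤ m → a′ ≤ m → 0 < b′ → b′ ≤ m → Coprime a b → Coprime a′ b′ →
      fraction p a b ≡ fraction p a′ b′ → a ≡ a′ × b ≡ b′
    fraction-injective-on-coprime {m} {a} {b} {a′} {b′} m<p w 0<a a≤m 0<b b≤m a′≤m 0<b′ b′≤m a⊥b a′⊥b′ same =
      coprime-cross-multiplication a⊥b a′⊥b′ 0<a (≡-mod-<⇒≡ cast (bound a≤m b′≤m) (bound a′≤m b≤m))
      where
      bound : ∀ {x y} → x ≤ m → y ≤ m → x ℕ.* y < p ℕ.* p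
      bound x≤m y≤m = ℕ.*-mono-< (ℕ.≤-<-trans x≤m m<p) (ℕ.≤-<-trans y≤m m<p)
      ab′≡a′b : + a * + b′ ≡ + a′ * + b mod P * P
      ab′≡a′b = fraction-injective {n} {+ a} {+ b} {+ a′} {+ b′} {+ fraction p a b} (fraction*b≡a prime 0<b (ℕ.≤-<-trans b≤m m<p))
                  (subst (λ c → + c * + b′ ≡ + a′ mod P) (sym same) (fraction*b≡a prime 0<b′ (ℕ.≤-<-trans b′≤m m<p)))
                  (wieferich-* {p} (w a≤m) (w b′≤m)) (wieferich-* {p} (w a′≤m) (w b≤m))
      cast : + (a ℕ.* b′) ≡ + (a′ ℕ.* b) mod + (p ℕ.* p)
      cast = subst₂ (λ x y → x ≡ y mod + (p ℕ.* p)) (sym (pos-* a b′)) (sym (pos-* a′ b))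
                    (subst (λ N → + a * + b′ ≡ + a′ * + b mod N) (sym (pos-* p p)) ab′≡a′b)


module Counting where

  open import Data.Bool using (if_then_else_; true; false)
  open import Data.List using (length; filter; applyUpTo)
  open import Data.Nat.Coprimality using (coprime?; gcd≡1⇒coprime)
  open import Data.Nat.GCD using (gcd; gcd[m,n]∣m; gcd[m,n]∣n; gcd[m,n]≡0⇒m≡0)
  open import Relation.Unary using (Pred; Decidable)
  open import Data.Fin as Fin using (Fin; zero; suc; toℕ; fromℕ<)
  open import Data.Fin.Properties as Fin using (toℕ-inject₁; toℕ-fromℕ; toℕ-fromℕ<; toℕ<n)
  open import Data.Nat
  open import Data.Nat.Properties
  open import Data.Product using (∃; _×_; _,_; proj₁; proj₂)
  open import Function using (_∘_; case_of_)
  open import Data.Nat.Tactic.RingSolver using (solve-∀)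
  open import Relation.Nullary using (Dec; yes; no; does; ¬_)
  open import Data.Nat.Divisibility using (_∣_; _∣?_; ∣⇒≤; ∣m+n∣m⇒∣n; m∣m*n; ∣m∣n⇒∣m+n; ∣-refl)
  open import Relation.Binary.PropositionalEquality
  open import Algebra.Properties.Semiring.Sum +-*-semiring
    using (sum-syntax; sum-cong-≗; ∑-comm; ∑-distrib-+; *-distribˡ-sum; *-distribʳ-sum; sum-init-last; sum-replicate-zero)

  𝟙 : ∀ {a} {A : Set a} → Dec A → ℕ
  𝟙 d = if does d then 1 else 0

  module _ {a} {A : Set a} where

    𝟙≤1 : (d : Dec A) → 𝟙 d ≤ 1
    𝟙≤1 (yes _) = s≤s z≤n
    𝟙≤1 (no _)  = z≤n

    𝟙-positive : (d : Dec A) → 0 < 𝟙 d → A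
    𝟙-positive (yes x) _ = x

    𝟙-yes : (d : Dec A) → A → 𝟙 d ≡ 1
    𝟙-yes (yes _) _ = refl
    𝟙-yes (no ¬x) x = case ¬x x of λ ()

  *-positiveˡ : ∀ m {n} → 0 < m * n → 0 < m
  *-positiveˡ (suc m) _ = s≤s z≤n

  *-positiveʳ : ∀ m {n} → 0 < m * n → 0 < n
  *-positiveʳ m {n} 0<mn = *-positiveˡ n (subst (0 <_) (*-comm m n) 0<mn)

  ∑-const : ∀ n c → ∑[ i < n ] c ≡ n * c
  ∑-const zero    c = refl
  ∑-const (suc n) c = cong (c +_) (∑-const n c)

  ∑-mono-≤ : ∀ {n} {f g : Fin n → ℕ} → (∀ i → f i ≤ g i) → ∑[ i < n ] f i ≤ ∑[ i < n ] g i
  ∑-mono-≤ {zero}  _   = z≤n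
  ∑-mono-≤ {suc n} f≤g = +-mono-≤ (f≤g zero) (∑-mono-≤ (f≤g ∘ suc))

  ∑-snoc : ∀ {n} (f : ℕ → ℕ) → ∑[ i < suc n ] f (toℕ i) ≡ ∑[ i < n ] f (toℕ i) + f n
  ∑-snoc {n} f = begin
    ∑[ i < suc n ] f (toℕ i)
      ≡⟨ sum-init-last (f ∘ toℕ) ⟩
    ∑[ i < n ] f (toℕ (Fin.inject₁ i)) + f (toℕ (Fin.fromℕ n))
      ≡⟨ cong₂ _+_ (sum-cong-≗ {n} (cong f ∘ toℕ-inject₁)) (cong f (toℕ-fromℕ n)) ⟩
    ∑[ i < n ] f (toℕ i) + f n ∎
    where open ≡-Reasoning

  term≤∑ : ∀ {n} (f : Fin n → ℕ) i → f i ≤ ∑[ j < n ] f j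
  term≤∑ f zero    = m≤m+n (f zero) _
  term≤∑ f (suc i) = ≤-trans (term≤∑ (f ∘ suc) i) (m≤n+m _ (f zero))

  ∑-positive : ∀ {n} (f : Fin n → ℕ) → 0 < ∑[ i < n ] f i → ∃ λ i → 0 < f i
  ∑-positive {suc n} f 0<∑ with f zero in f₀≡
  ... | suc _ = zero , subst (0 <_) (sym f₀≡) (s≤s z≤n)
  ... | zero  = let i , 0<fi = ∑-positive (f ∘ suc) 0<∑ in suc i , 0<fi

  ∑-≤1 : ∀ {n} (f : Fin n → ℕ) → (∀ i → f i ≤ 1) → (∀ i j → 0 < f i → 0 < f j → i ≡ j) →
         ∑[ i < n ] f i ≤ 1
  ∑-≤1 {zero}  f _   _      = z≤n
  ∑-≤1 {suc n} f f≤1 unique with f zero in f₀≡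
  ... | zero  = ∑-≤1 (f ∘ suc) (f≤1 ∘ suc) (λ i j 0<fi 0<fj → Fin.suc-injective (unique (suc i) (suc j) 0<fi 0<fj))
  ... | suc x = subst (_≤ 1) (trans (trans f₀≡ (sym (+-identityʳ (suc x)))) (cong (suc x +_) (sym rest≡0))) (f≤1 zero)
    where
    rest≡0 : ∑[ i < n ] f (suc i) ≡ 0
    rest≡0 with ∑[ i < n ] f (suc i) in rest
    ... | zero  = refl
    ... | suc _ with ∑-positive (f ∘ suc) (subst (0 <_) (sym rest) (s≤s z≤n))
    ...   | i , 0<fi = case unique zero (suc i) (subst (0 <_) (sym f₀≡) (s≤s z≤n)) 0<fi of λ ()

  ∑∑-≤1 : ∀ {m n} (α : Fin m → Fin n → ℕ) → (∀ i k → α i k ≤ 1) →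
          (∀ i k i′ k′ → 0 < α i k → 0 < α i′ k′ → i ≡ i′ × k ≡ k′) →
          ∑[ i < m ] ∑[ k < n ] α i k ≤ 1
  ∑∑-≤1 {n = n} α α≤1 unique = ∑-≤1 (λ i → ∑[ k < n ] α i k) row≤1 rows-unique
    where
    row≤1 : ∀ i → ∑[ k < n ] α i k ≤ 1
    row≤1 i = ∑-≤1 (α i) (α≤1 i) (λ k k′ 0<α 0<α′ → proj₂ (unique i k i k′ 0<α 0<α′))
    rows-unique : ∀ i i′ → 0 < ∑[ k < n ] α i k → 0 < ∑[ k < n ] α i′ k → i ≡ i′
    rows-unique i i′ 0<row 0<row′ with ∑-positive (α i) 0<row | ∑-positive (α i′) 0<row′
    ... | k , 0<α | k′ , 0<α′ = proj₁ (unique i k i′ k′ 0<α 0<α′)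

  ∑-𝟙-≡1 : ∀ {N} (c : Fin N) → ∑[ c′ < N ] 𝟙 (c Fin.≟ c′) ≡ 1
  ∑-𝟙-≡1 {suc N} zero    = cong suc (sum-replicate-zero N)
  ∑-𝟙-≡1 {suc N} (suc c) = ∑-𝟙-≡1 c

  -- Each α-point (i , k) is counted once, in the fibre over g i k; an injective g puts at most
  -- one point in each fibre, and only in fibres where β is positive.
  double-counting : ∀ {m n N} (α : Fin m → Fin n → ℕ) (β : Fin N → ℕ) (g : Fin m → Fin n → Fin N) →
                    (∀ i k → α i k ≤ 1) → (∀ i k → 0 < α i k → 0 < β (g i k)) →
                    (∀ i k i′ k′ → 0 < α i k → 0 < α i′ k′ → g i k ≡ g i′ k′ → i ≡ i′ × k ≡ k′) →
                    ∑[ i < m ] ∑[ k < n ] α i k ≤ ∑[ c < N ] β c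
  double-counting {m} {n} {N} α β g α≤1 α⇒β g-injective = begin
    ∑[ i < m ] ∑[ k < n ] α i k                  ≡⟨ sum-cong-≗ (λ i → sum-cong-≗ (λ k → split i k)) ⟩
    ∑[ i < m ] ∑[ k < n ] ∑[ c < N ] F c i k     ≡⟨ sum-cong-≗ (λ i → ∑-comm (λ k c → F c i k)) ⟩
    ∑[ i < m ] ∑[ c < N ] ∑[ k < n ] F c i k     ≡⟨ ∑-comm (λ i c → ∑[ k < n ] F c i k) ⟩
    ∑[ c < N ] ∑[ i < m ] ∑[ k < n ] F c i k     ≤⟨ ∑-mono-≤ fibre≤β ⟩
    ∑[ c < N ] β c                               ∎
    where
    open ≤-Reasoning
    F : Fin N → Fin m → Fin n → ℕ
    F c i k = α i k * 𝟙 (g i k Fin.≟ c)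
    split : ∀ i k → α i k ≡ ∑[ c < N ] F c i k
    split i k = begin-equality
      α i k                                    ≡⟨ sym (*-identityʳ (α i k)) ⟩
      α i k * 1                                ≡⟨ cong (α i k *_) (sym (∑-𝟙-≡1 (g i k))) ⟩
      α i k * ∑[ c < N ] 𝟙 (g i k Fin.≟ c)     ≡⟨ *-distribˡ-sum (α i k) (λ c → 𝟙 (g i k Fin.≟ c)) ⟩
      ∑[ c < N ] F c i k                       ∎
    in-fibre : ∀ {c i k} → 0 < F c i k → 0 < α i k × g i k ≡ c
    in-fibre {c} {i} {k} 0<F = *-positiveˡ (α i k) 0<F , 𝟙-positive (g i k Fin.≟ c) (*-positiveʳ (α i k) 0<F)
    fibre≤1 : ∀ c → ∑[ i < m ] ∑[ k < n ] F c i k ≤ 1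
    fibre≤1 c = ∑∑-≤1 (F c) (λ i k → *-mono-≤ (α≤1 i k) (𝟙≤1 (g i k Fin.≟ c))) λ i k i′ k′ 0<F 0<F′ →
      let 0<α , gik≡c = in-fibre 0<F ; 0<α′ , gi′k′≡c = in-fibre 0<F′
      in g-injective i k i′ k′ 0<α 0<α′ (trans gik≡c (sym gi′k′≡c))
    fibre≤β : ∀ c → ∑[ i < m ] ∑[ k < n ] F c i k ≤ β c
    fibre≤β c with ∑[ i < m ] ∑[ k < n ] F c i k in fibre | fibre≤1 c
    ... | zero  | _ = z≤n
    ... | suc _ | fibre≤1′ with ∑-positive (λ i → ∑[ k < n ] F c i k) (subst (0 <_) (sym fibre) (s≤s z≤n))
    ...   | i , 0<row with ∑-positive (F c i) 0<row
    ...     | k , 0<F = let 0<α , gik≡c = in-fibre 0<F in ≤-trans fibre≤1′ (subst (λ c → 0 < β c) gik≡c (α⇒β i k 0<α))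

  𝟙-no : ∀ {a} {A : Set a} (d : Dec A) → ¬ A → 𝟙 d ≡ 0
  𝟙-no (yes x) ¬x = case ¬x x of λ ()
  𝟙-no (no _)  _  = refl

  multiples : ℕ → ℕ → ℕ
  multiples d m = ∑[ i < m ] 𝟙 (d ∣? suc (toℕ i))

  multiples-division : ∀ d .{{_ : NonZero d}} m → ∃ λ r → r < d × d * multiples d m + r ≡ m
  multiples-division d zero = 0 , >-nonZero⁻¹ d , trans (+-identityʳ (d * 0)) (*-zeroʳ d)
  multiples-division d (suc m) with multiples-division d m | d ∣? suc m
  ... | r , r<d , dc+r≡m | yes d∣1+m = 0 , >-nonZero⁻¹ d , (begin-equality
    d * multiples d (suc m) + 0        ≡⟨ +-identityʳ _ ⟩
    d * multiples d (suc m)            ≡⟨ cong (d *_) (trans (∑-snoc (λ i → 𝟙 (d ∣? suc i))) (cong (c +_) (𝟙-yes (d ∣? suc m) d∣1+m))) ⟩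
    d * (c + 1)                        ≡⟨ trans (*-distribˡ-+ d c 1) (cong (d * c +_) (*-identityʳ d)) ⟩
    d * c + d                          ≡⟨ cong (d * c +_) (sym 1+r≡d) ⟩
    d * c + suc r                      ≡⟨ +-suc (d * c) r ⟩
    suc (d * c + r)                    ≡⟨ cong suc dc+r≡m ⟩
    suc m                              ∎)
    where
    open ≤-Reasoning
    c : ℕ
    c = multiples d m
    1+r≡d : suc r ≡ d
    1+r≡d = ≤-antisym r<d (∣⇒≤ (∣m+n∣m⇒∣n (subst (d ∣_) (sym (trans (+-suc (d * c) r) (cong suc dc+r≡m))) d∣1+m) (m∣m*n c)))
  ... | r , r<d , dc+r≡m | no d∤1+m = suc r , 1+r<d , (begin-equality
    d * multiples d (suc m) + suc r
      ≡⟨ cong (λ x → d * x + suc r) (trans (∑-snoc (λ i → 𝟙 (d ∣? suc i))) (cong (c +_) (𝟙-no (d ∣? suc m) d∤1+m))) ⟩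
    d * (c + 0) + suc r
      ≡⟨ cong (λ x → d * x + suc r) (+-identityʳ c) ⟩
    d * c + suc r
      ≡⟨ +-suc (d * c) r ⟩
    suc (d * c + r)
      ≡⟨ cong suc dc+r≡m ⟩
    suc m ∎)
    where
    open ≤-Reasoning
    c : ℕ
    c = multiples d m
    1+r<d : suc r < d
    1+r<d = ≤∧≢⇒< r<d λ 1+r≡d → d∤1+m (subst (d ∣_) (trans (+-suc (d * c) r) (cong suc dc+r≡m))
                                                      (∣m∣n⇒∣m+n (m∣m*n c) (subst (d ∣_) (sym 1+r≡d) ∣-refl)))

  multiples-bound : ∀ d .{{_ : NonZero d}} m → d * multiples d m ≤ m
  multiples-bound d m with r , _ , dc+r≡m ← multiples-division d m = subst (d * multiples d m ≤_) dc+r≡m (m≤m+n _ r)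

  module _ (m : ℕ) (t : ℕ → ℕ) (t-bound : ∀ d → (2 + d) * t d ≤ m) where

    private
      M : ℕ
      M = m * m
      U : ℕ → ℕ
      U n = ∑[ d < n ] (t (toℕ d) * t (toℕ d))

    -- Σ_{d ≥ 2} 1/d² < 2/3, in the telescoping form Σ_{d=2}^{n+1} 1/d² ≤ 2/3 − 2/(2n+3),
    -- using 1/d² ≤ 2/(2d−1) − 2/(2d+1).
    ∑-inverse-squares : ∀ n → (3 + 2 * n) * (3 * U n) + 6 * M ≤ (3 + 2 * n) * (2 * M)
    ∑-inverse-squares zero    = ≤-reflexive (trans (cong (λ x → x + 6 * M) (*-zeroʳ 3 )) (solve-∀′ M))
      where
      solve-∀′ : ∀ M → 0 + 6 * M ≡ 3 * (2 * M)
      solve-∀′ = solve-∀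
    ∑-inverse-squares (suc n) = subst (λ k → k * (3 * U (suc n)) + 6 * M ≤ k * (2 * M)) (K′≡ n)
                                (*-cancelˡ-≤ K (+-cancelʳ-≤ (6 * M * K′) _ _ (begin
      K * (K′ * (3 * U (suc n)) + 6 * M) + 6 * M * K′
        ≡⟨ cong (λ u → K * (K′ * (3 * u) + 6 * M) + 6 * M * K′) (∑-snoc {n} (λ d → t d * t d)) ⟩
      K * (K′ * (3 * (u + x * x)) + 6 * M) + 6 * M * K′
        ≡⟨ regroup n u x M ⟩
      K′ * (K * (3 * u) + 6 * M) + 3 * (K * K′ * (x * x)) + 6 * M * K
        ≤⟨ +-monoˡ-≤ (6 * M * K) (+-mono-≤ (*-monoʳ-≤ K′ (∑-inverse-squares n)) (*-monoʳ-≤ 3 last-term)) ⟩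
      K′ * (K * (2 * M)) + 3 * (4 * M) + 6 * M * K
        ≡⟨ regroup′ n M ⟩
      K * (K′ * (2 * M)) + 6 * M * K′ ∎)))
      where
      open ≤-Reasoning
      K′≡ : ∀ n → 5 + 2 * n ≡ 3 + 2 * suc n
      K′≡ = solve-∀
      K : ℕ
      K = 3 + 2 * n
      K′ : ℕ
      K′ = 5 + 2 * n
      u : ℕ
      u = U n
      x : ℕ
      x = t n
      regroup : ∀ n u x M → (3 + 2 * n) * ((5 + 2 * n) * (3 * (u + x * x)) + 6 * M) + 6 * M * (5 + 2 * n)
                          ≡ (5 + 2 * n) * ((3 + 2 * n) * (3 * u) + 6 * M) + 3 * ((3 + 2 * n) * (5 + 2 * n) * (x * x)) + 6 * M * (3 + 2 * n)
      regroup = solve-∀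
      regroup′ : ∀ n M → (5 + 2 * n) * ((3 + 2 * n) * (2 * M)) + 3 * (4 * M) + 6 * M * (3 + 2 * n)
                       ≡ (3 + 2 * n) * ((5 + 2 * n) * (2 * M)) + 6 * M * (5 + 2 * n)
      regroup′ = solve-∀
      KK′≤4[2+n]² : K * K′ ≤ 4 * ((2 + n) * (2 + n))
      KK′≤4[2+n]² = subst (K * K′ ≤_) (square n) (n≤1+n (K * K′))
        where
        square : ∀ n → suc ((3 + 2 * n) * (5 + 2 * n)) ≡ 4 * ((2 + n) * (2 + n))
        square = solve-∀
      last-term : K * K′ * (x * x) ≤ 4 * M
      last-term = begin
        K * K′ * (x * x)                       ≤⟨ *-monoˡ-≤ (x * x) KK′≤4[2+n]² ⟩
        4 * ((2 + n) * (2 + n)) * (x * x)      ≡⟨ rearrange (2 + n) x ⟩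
        4 * (((2 + n) * x) * ((2 + n) * x))    ≤⟨ *-monoʳ-≤ 4 (*-mono-≤ (t-bound n) (t-bound n)) ⟩
        4 * M                                  ∎
        where
        rearrange : ∀ a x → 4 * (a * a) * (x * x) ≡ 4 * ((a * x) * (a * x))
        rearrange = solve-∀

    ∑-squares-bound : ∀ n → 3 * U n ≤ 2 * M
    ∑-squares-bound n = *-cancelˡ-≤ (3 + 2 * n) (≤-trans (m≤m+n _ (6 * M)) (∑-inverse-squares n))

  length-filter-applyUpTo : ∀ {p} {P : Pred ℕ p} (P? : Decidable P) f n →
                            length (filter P? (applyUpTo f n)) ≡ ∑[ i < n ] 𝟙 (P? (f (toℕ i)))
  length-filter-applyUpTo P? f zero = refl
  length-filter-applyUpTo P? f (suc n) with does (P? (f 0))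
  ... | true  = cong suc (length-filter-applyUpTo P? (f ∘ suc) n)
  ... | false = length-filter-applyUpTo P? (f ∘ suc) n

  coprimePairs : ℕ → ℕ
  coprimePairs m = ∑[ i < m ] ∑[ k < m ] 𝟙 (coprime? (suc (toℕ i)) (suc (toℕ k)))

  common-divisor : ∀ {m a b} → 0 < a → a ≤ m →
                   1 ≤ 𝟙 (coprime? a b) + ∑[ d < m ∸ 1 ] (𝟙 (2 + toℕ d ∣? a) * 𝟙 (2 + toℕ d ∣? b))
  common-divisor {m} {a} {b} 0<a a≤m with coprime? a b
  ... | yes a⊥b  = ≤-trans (≤-reflexive (sym (𝟙-yes (coprime? a b) a⊥b))) (m≤m+n _ _)
  ... | no ¬a⊥b = ≤-trans 1≤term (≤-trans (term≤∑ (λ d′ → 𝟙 (2 + toℕ d′ ∣? a) * 𝟙 (2 + toℕ d′ ∣? b)) (fromℕ< d<m-1))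
                                            (m≤n+m _ (𝟙 (coprime? a b))))
    where
    gcd≥2 : ∃ λ d → gcd a b ≡ 2 + d
    gcd≥2 with gcd a b in gcd≡
    ... | zero        = case trans (sym (gcd[m,n]≡0⇒m≡0 gcd≡)) (sym (suc-pred a {{>-nonZero 0<a}})) of λ ()
    ... | suc zero    = case ¬a⊥b (gcd≡1⇒coprime gcd≡) of λ ()
    ... | suc (suc d) = d , refl
    d : ℕ
    d = proj₁ gcd≥2
    g∣a : 2 + d ∣ a
    g∣a = subst (_∣ a) (proj₂ gcd≥2) (gcd[m,n]∣m a b)
    g∣b : 2 + d ∣ b
    g∣b = subst (_∣ b) (proj₂ gcd≥2) (gcd[m,n]∣n a b)
    d<m-1 : d < m ∸ 1
    d<m-1 = ∸-monoˡ-≤ 1 (≤-trans (∣⇒≤ {{>-nonZero 0<a}} g∣a) a≤m)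
    1≤term : 1 ≤ 𝟙 (2 + toℕ (fromℕ< d<m-1) ∣? a) * 𝟙 (2 + toℕ (fromℕ< d<m-1) ∣? b)
    1≤term rewrite toℕ-fromℕ< d<m-1 | 𝟙-yes (2 + d ∣? a) g∣a | 𝟙-yes (2 + d ∣? b) g∣b = s≤s z≤n

  sieve : ∀ m → m * m ≤ coprimePairs m + ∑[ d < m ∸ 1 ] (multiples (2 + toℕ d) m * multiples (2 + toℕ d) m)
  sieve m = begin
    m * m
      ≡⟨ sym (trans (sum-cong-≗ {m} (λ _ → trans (∑-const m 1) (*-identityʳ m))) (∑-const m m)) ⟩
    ∑[ i < m ] ∑[ k < m ] 1
      ≤⟨ ∑-mono-≤ {m} (λ i → ∑-mono-≤ {m} (λ k → common-divisor {m} {suc (toℕ i)} {suc (toℕ k)} (s≤s z≤n) (toℕ<n i))) ⟩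
    ∑[ i < m ] ∑[ k < m ] (C i k + ∑[ d < m ∸ 1 ] (A d i * A d k))
      ≡⟨ sum-cong-≗ (λ i → ∑-distrib-+ (C i) (λ k → ∑[ d < m ∸ 1 ] (A d i * A d k))) ⟩
    ∑[ i < m ] (∑[ k < m ] C i k + ∑[ k < m ] ∑[ d < m ∸ 1 ] (A d i * A d k))
      ≡⟨ ∑-distrib-+ (λ i → ∑[ k < m ] C i k) (λ i → ∑[ k < m ] ∑[ d < m ∸ 1 ] (A d i * A d k)) ⟩
    coprimePairs m + ∑[ i < m ] ∑[ k < m ] ∑[ d < m ∸ 1 ] (A d i * A d k)
      ≡⟨ cong (coprimePairs m +_) factorise ⟩
    coprimePairs m + ∑[ d < m ∸ 1 ] (T d * T d) ∎
    where
    open ≤-Reasoning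
    C : Fin m → Fin m → ℕ
    C i k = 𝟙 (coprime? (suc (toℕ i)) (suc (toℕ k)))
    A : Fin (m ∸ 1) → Fin m → ℕ
    A d i = 𝟙 (2 + toℕ d ∣? suc (toℕ i))
    T : Fin (m ∸ 1) → ℕ
    T d = multiples (2 + toℕ d) m
    factorise : ∑[ i < m ] ∑[ k < m ] ∑[ d < m ∸ 1 ] (A d i * A d k) ≡ ∑[ d < m ∸ 1 ] (T d * T d)
    factorise = begin-equality
      ∑[ i < m ] ∑[ k < m ] ∑[ d < m ∸ 1 ] (A d i * A d k)   ≡⟨ sum-cong-≗ (λ i → ∑-comm (λ k d → A d i * A d k)) ⟩
      ∑[ i < m ] ∑[ d < m ∸ 1 ] ∑[ k < m ] (A d i * A d k)   ≡⟨ ∑-comm (λ i d → ∑[ k < m ] (A d i * A d k)) ⟩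
      ∑[ d < m ∸ 1 ] ∑[ i < m ] ∑[ k < m ] (A d i * A d k)   ≡⟨ sum-cong-≗ (λ d → sum-cong-≗ (λ i → sym (*-distribˡ-sum (A d i) (A d)))) ⟩
      ∑[ d < m ∸ 1 ] ∑[ i < m ] (A d i * T d)                 ≡⟨ sum-cong-≗ (λ d → sym (*-distribʳ-sum (T d) (A d))) ⟩
      ∑[ d < m ∸ 1 ] (T d * T d)                              ∎

  coprimePairs-bound : ∀ m → m * m ≤ 3 * coprimePairs m
  coprimePairs-bound m = +-cancelʳ-≤ (2 * (m * m)) (m * m) (3 * coprimePairs m) (begin
    m * m + 2 * (m * m)
      ≡⟨⟩
    3 * (m * m)
      ≤⟨ *-monoʳ-≤ 3 (sieve m) ⟩
    3 * (coprimePairs m + U)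
      ≡⟨ *-distribˡ-+ 3 (coprimePairs m) U ⟩
    3 * coprimePairs m + 3 * U
      ≤⟨ +-monoʳ-≤ (3 * coprimePairs m) (∑-squares-bound m t (λ d → multiples-bound (2 + d) m) (m ∸ 1)) ⟩
    3 * coprimePairs m + 2 * (m * m) ∎)
    where
    open ≤-Reasoning
    t : ℕ → ℕ
    t d = multiples (2 + d) m
    U : ℕ
    U = ∑[ d < m ∸ 1 ] (t (toℕ d) * t (toℕ d))


module KappaBound where

  open MirimanoffCriterion
  open Computations
  open Fractions
  open Counting
  open import Data.Fin as Fin using (Fin; toℕ; fromℕ<)
  open import Data.Fin.Properties using (toℕ-fromℕ<; toℕ<n; toℕ-injective)
  open import Data.Nat
  open import Data.Nat.Properties
  open import Data.Nat.Coprimality using (coprime?)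
  open import Data.Nat.DivMod using (_%_; _/_; m≡m%n+[m/n]*n; m%n<n)
  open import Data.Nat.Divisibility using (_∣_; m%n≡0⇒n∣m)
  open import Data.Nat.Primality using (Prime; prime⇒nonTrivial)
  open import Data.Nat.Tactic.RingSolver using (solve-∀)
  open import Data.Integer using (+_)
  open import Data.Product using (∃-syntax; _×_; _,_; proj₁; proj₂)
  open import Function using (id; case_of_)
  open import Relation.Nullary using (¬_)
  open import Relation.Binary.PropositionalEquality
  open import Algebra.Properties.Semiring.Sum +-*-semiring using (sum-syntax)

  module _ {k : ℕ} (prime : Prime (suc (k * 2))) where

    private
      n : ℕ
      n = k * 2
      p : ℕ
      p = suc n

    coprimePairs≤eta0 : ∀ {m} → m < p → WieferichUpTo p m → coprimePairs m ≤ eta0 p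
    coprimePairs≤eta0 {m} m<p w = subst (coprimePairs m ≤_) (sym eta0≡) (double-counting α β g α≤1 α⇒β g-injective)
      where
      α : Fin m → Fin m → ℕ
      α i j = 𝟙 (coprime? (suc (toℕ i)) (suc (toℕ j)))
      α≤1 : ∀ i j → α i j ≤ 1
      α≤1 i j = 𝟙≤1 (coprime? (suc (toℕ i)) (suc (toℕ j)))
      β : Fin p → ℕ
      β c = 𝟙 (mirimanoff p (toℕ c) ≟ 0)
      g : Fin m → Fin m → Fin p
      g i j = fromℕ< (fraction<p p (suc (toℕ i)) (suc (toℕ j)))
      eta0≡ : eta0 p ≡ ∑[ c < p ] β c
      eta0≡ = length-filter-applyUpTo (λ c → mirimanoff p c ≟ 0) id p
      α⇒β : ∀ i j → 0 < α i j → 0 < β (g i j)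
      α⇒β i j _ = subst (0 <_) (sym (𝟙-yes (mirimanoff p (toℕ (g i j)) ≟ 0) γ≡0)) (s≤s z≤n)
        where
        γ≡0 : mirimanoff p (toℕ (g i j)) ≡ 0
        γ≡0 = subst (λ c → mirimanoff p c ≡ 0) (sym (toℕ-fromℕ< _))
                    (mirimanoff[fraction]≡0 {k} prime m<p w (toℕ<n i) (s≤s z≤n) (toℕ<n j))
      g-injective : ∀ i j i′ j′ → 0 < α i j → 0 < α i′ j′ → g i j ≡ g i′ j′ → i ≡ i′ × j ≡ j′
      g-injective i j i′ j′ 0<α 0<α′ g≡g′ =
        toℕ-injective (suc-injective (proj₁ same-fraction)) , toℕ-injective (suc-injective (proj₂ same-fraction))
        where
        same-fraction : suc (toℕ i) ≡ suc (toℕ i′) × suc (toℕ j) ≡ suc (toℕ j′)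
        same-fraction = fraction-injective-on-coprime {k} prime m<p w
          (s≤s z≤n) (toℕ<n i) (s≤s z≤n) (toℕ<n j) (toℕ<n i′) (s≤s z≤n) (toℕ<n j′)
          (𝟙-positive (coprime? _ _) 0<α) (𝟙-positive (coprime? _ _) 0<α′)
          (trans (sym (toℕ-fromℕ< _)) (trans (cong toℕ g≡g′) (toℕ-fromℕ< _)))

    private
      κ : ℕ
      κ = kappa p
      m : ℕ
      m = (κ ∸ 1) ⊓ n

    wieferich-up-to-m : WieferichUpTo p m
    wieferich-up-to-m {zero}  _   = wieferich-0 n
    wieferich-up-to-m {suc j} j<m =
      wieferich-below-kappa prime (s≤s z≤n) j<κ (s≤s (≤-trans j<m (m⊓n≤n (κ ∸ 1) n)))
      where
      j<κ : suc j < κ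
      j<κ = ≤-trans (s≤s (≤-trans j<m (m⊓n≤m (κ ∸ 1) n))) (≤-reflexive (m+[n∸m]≡n (≤-trans (s≤s z≤n) (2≤kappa prime))))

    -- κ ≤ p + 2 is all the search in the definition of kappa guarantees; it suffices.
    kappa≤4m : κ ≤ 4 * m
    kappa≤4m = ≤-trans κ≤m+3 (≤-trans (+-monoʳ-≤ m (*-monoʳ-≤ 3 1≤m)) (≤-reflexive (m+3m≡4m m)))
      where
      m+3m≡4m : ∀ m → m + 3 * m ≡ 4 * m
      m+3m≡4m = solve-∀
      1≤m : 1 ≤ m
      1≤m = ⊓-glb (∸-monoˡ-≤ 1 (2≤kappa prime)) (s≤s⁻¹ (nonTrivial⇒n>1 p {{prime⇒nonTrivial prime}}))
      κ≤m+3 : κ ≤ m + 3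
      κ≤m+3 = subst (κ ≤_) (sym (+-distribʳ-⊓ 3 (κ ∸ 1) n))
                (⊓-glb (≤-trans (≤-reflexive (sym (m∸n+n≡m (≤-trans (s≤s z≤n) (2≤kappa prime))))) (+-monoʳ-≤ (κ ∸ 1) (s≤s z≤n)))
                       (subst (κ ≤_) (sym (+-suc n 2)) (kappa≤p+2 prime)))

    kappa-bound : kappa p ^ 2 ≤ 48 * eta0 p
    kappa-bound = begin
      κ ^ 2                        ≡⟨ cong (κ *_) (*-identityʳ κ) ⟩
      κ * κ                        ≤⟨ *-mono-≤ kappa≤4m kappa≤4m ⟩
      (4 * m) * (4 * m)            ≡⟨ regroup m ⟩
      16 * (m * m)                 ≤⟨ *-monoʳ-≤ 16 (coprimePairs-bound m) ⟩
      16 * (3 * coprimePairs m)    ≡⟨ sym (*-assoc 16 3 (coprimePairs m)) ⟩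
      48 * coprimePairs m          ≤⟨ *-monoʳ-≤ 48 (coprimePairs≤eta0 (s≤s (m⊓n≤n (κ ∸ 1) n)) wieferich-up-to-m) ⟩
      48 * eta0 p                  ∎
      where
      open ≤-Reasoning
      regroup : ∀ m → (4 * m) * (4 * m) ≡ 16 * (m * m)
      regroup = solve-∀

  odd⇒≡suc[k*2] : ∀ {p} → ¬ 2 ∣ p → p ≡ suc (p / 2 * 2)
  odd⇒≡suc[k*2] {p} 2∤p = trans (m≡m%n+[m/n]*n p 2) (cong (_+ p / 2 * 2) p%2≡1)
    where
    p%2≡1 : p % 2 ≡ 1
    p%2≡1 with p % 2 in p%2 | m%n<n p 2
    ... | zero        | _ = case 2∤p (m%n≡0⇒n∣m p 2 p%2) of λ ()
    ... | suc zero    | _ = refl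
    ... | suc (suc _) | s≤s (s≤s ())


open import Data.Nat using (ℕ; _*_; _^_; _≤_; _/_)
open import Data.Nat.Primality using (Prime)
open import Data.Nat.Divisibility using (_∣_)
open import Data.Product using (∃-syntax; _,_)
open import Relation.Nullary using (¬_)
open import Relation.Binary.PropositionalEquality using (subst; sym)
open KappaBound using (kappa-bound; odd⇒≡suc[k*2])

theorem1 : ∃[ D ] ((p : ℕ) → Prime p → ¬ (2 ∣ p) → kappa p ^ 2 ≤ D * eta0 p)
theorem1 = 48 , λ p prime 2∤p →
  subst (λ q → kappa q ^ 2 ≤ 48 * eta0 q) (sym (odd⇒≡suc[k*2] 2∤p)) (kappa-bound {p / 2} (subst Prime (odd⇒≡suc[k*2] 2∤p) prime))
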